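{- If $n$ is an odd prime, then there exists a generator path for $n$.
   Context: Label the vertices of $K_n$ by $1,\dots,n$, identified with residues modulo $n$ and arranged clockwise on a regular polygon. For vertices $u,v$, the clockwise distance is $cd(u,v)=\min(|u-v|, n-|u-v|)$. The type of an edge $\{u,v\}$ is $\min(|u-v|, n-|u-v|) \in \{1,\dots,\lfloor n/2\rfloor\}$; an edge of type $x$ is an $x$-type edge. For odd $n$, an $x$-type edge can be written uniquely as $\{v, v+x\}$ (mod $n$), and $v$ is its starting vertex. For edges $e,e'$, $cd(e,e')$ is the clockwise distance between their starting vertices. For odd $n$, a path $P$ in $K_n$ is a generator path for $n$ if: (GP1) $P$ contains at least one edge of each of the $\frac{n-1}{2}$ types; (GP2) at most one edge type appears exactly once in $P$, and no edge type appears more than twice in $P$; (GP3) whenever $e,e'$ are two $x$-type edges in $P$ with $cd(e,e')=d$, and $h,h'$ are two other edges of $P$ both of a type $y\neq x$, we have $cd(h,h')\neq d$. -}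

module Defs where

open import Data.Nat.Base using (ℕ; zero; suc; _+_; _*_; _∸_; _≤_; _<_; _≤ᵇ_; _≡ᵇ_; _⊓_; ∣_-_∣; ⌊_/2⌋)
open import Data.Nat.Primality using (Prime)
open import Data.Nat.DivMod using (_%_)
open import Data.Bool.Base using (Bool; true; false; if_then_else_)
open import Data.Fin.Base using (Fin; toℕ)
open import Data.List.Base using (List; []; _∷_; length; lookup)
open import Data.List.Relation.Unary.Unique.Propositional using (Unique)
open import Data.Product using (_×_; _,_; Σ-syntax)
open import Relation.Binary.PropositionalEquality using (_≡_; _≢_)

-- An edge of K_n, given by its two endpoints (labels 0..n-1, i.e. residues mod n).
Edge : Set
Edge = ℕ × ℕ

cd : ℕ → ℕ → ℕ → ℕ
cd n u v = ∣ u - v ∣ ⊓ (n ∸ ∣ u - v ∣)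

etype : ℕ → Edge → ℕ
etype n (u , v) = cd n u v

diffMod : ℕ → ℕ → ℕ → ℕ
diffMod n u v = if u ≤ᵇ v then v ∸ u else (v + n) ∸ u

-- starting vertex of an x-type edge {u,v} (n odd): the endpoint s with
-- the edge equal to {s, s + x mod n}
start : ℕ → Edge → ℕ
start n (u , v) = if diffMod n u v ≡ᵇ etype n (u , v) then u else v

cdE : ℕ → Edge → Edge → ℕ
cdE n e e' = cd n (start n e) (start n e')

pathEdges : {n : ℕ} → List (Fin n) → List Edge
pathEdges [] = []
pathEdges (u ∷ []) = []
pathEdges (u ∷ v ∷ vs) = (toℕ u , toℕ v) ∷ pathEdges (v ∷ vs)

countType : ℕ → ℕ → List Edge → ℕ
countType n x [] = 0
countType n x (e ∷ es) = (if etype n e ≡ᵇ x then 1 else 0) + countType n x es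

IsPath : {n : ℕ} → List (Fin n) → Set
IsPath P = Unique P

GP1 : (n : ℕ) → List (Fin n) → Set
GP1 n P = ∀ x → 1 ≤ x → x ≤ ⌊ n /2⌋ → 1 ≤ countType n x (pathEdges P)

GP2 : (n : ℕ) → List (Fin n) → Set
GP2 n P =
  (∀ x y → countType n x (pathEdges P) ≡ 1 → countType n y (pathEdges P) ≡ 1 → x ≡ y)
  × (∀ x → countType n x (pathEdges P) ≤ 2)

GP3 : (n : ℕ) → List (Fin n) → Set
GP3 n P = ∀ (i j k l : Fin (length (pathEdges P))) →
  let E = lookup (pathEdges P) in
  i ≢ j → k ≢ l → i ≢ k → i ≢ l → j ≢ k → j ≢ l →
  etype n (E i) ≡ etype n (E j) →
  etype n (E k) ≡ etype n (E l) →
  etype n (E k) ≢ etype n (E i) →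
  cdE n (E k) (E l) ≢ cdE n (E i) (E j)

IsGeneratorPath : (n : ℕ) → List (Fin n) → Set
IsGeneratorPath n P = IsPath P × GP1 n P × GP2 n P × GP3 n P

-- Let p = 2m + 1 and let g be a primitive root modulo p. The path visits the residues of
-- g⁰, g¹, …, g^(2m-1), which are distinct; its k-th edge joins gᵏ and gᵏ⁺¹, so its type is the
-- cyclic distance ‖gᵏ(g - 1)‖ of that difference from 0. As gᵐ ≡ -1, the edges k and k + m have
-- the same type, while the types of the edges 0, …, m-1 are distinct and hence exhaust 1, …, m:
-- every type occurs twice, except the type of edge m-1, which occurs once. Two edges of the same
-- type are k and k + m, and the distance between their starting vertices is ‖gᵏ(g + 1)‖, which
-- determines ±gᵏ and hence the type; this is GP3.
-- A primitive root exists: if a has order e < p - 1, then Xᵉ - 1, having at most e roots, misses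
-- some x ≢ 0; the order s of x does not divide e, and a prime power tᵏ ∣ s with tᵏ ∤ e combines
-- a power of a with a power of x into an element of order larger than e.

module Submission where

open import Defs
open import Data.Nat.Base using (ℕ)
open import Data.Nat.Primality using (Prime)
open import Data.Nat.DivMod using (_%_)
open import Data.Fin.Base using (Fin)
open import Data.List.Base using (List)
open import Data.Product using (Σ-syntax)
open import Relation.Binary.PropositionalEquality using (_≡_)
import Data.Nat.Base as ℕ
open import Data.Nat.DivMod using (_/_)
open import Data.Product using (_,_)
open import Relation.Binary.PropositionalEquality using (subst; sym)

module Arithmetic where

  open import Data.Nat.Base
  open import Data.Nat.Properties
  open import Data.Nat.Divisibility
  open import Data.Nat.Coprimality using (Coprime; coprime-divisor) renaming (sym to Coprime-sym)
  open import Data.Nat.Primality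
  open import Data.Nat.Induction using (<-rec)
  open import Data.Nat.DivMod using (_%_; _/_; m≡m%n+[m/n]*n)
  open import Data.Product using (∃; ∃₂; ∃-syntax; _×_; _,_)
  open import Function using (case_of_; _∘_)
  open import Data.Bool.Base using (true; false; T; if_then_else_)
  open import Data.Sum.Base using (inj₁; inj₂; [_,_]′)
  import Relation.Unary as U
  open import Data.Empty using (⊥-elim)
  open import Relation.Nullary using (¬_; Dec; yes; no)
  open import Relation.Binary.PropositionalEquality

  Least : (ℕ → Set) → ℕ → Set
  Least P m = P m × (∀ {k} → k < m → ¬ P k)

  least : ∀ {P : ℕ → Set} → U.Decidable P → ∀ {n} → P n → ∃ (Least P)
  least {P} P? {n} = <-rec (λ n → P n → ∃ (Least P)) step n
    where
    step : ∀ n → (∀ {k} → k < n → P k → ∃ (Least P)) → P n → ∃ (Least P)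
    step n rec Pn with anyUpTo? P? n
    ... | yes (k , k<n , Pk) = rec k<n Pk
    ... | no ∄k              = n , Pn , λ k<n Pk → ∄k (_ , k<n , Pk)

  if-≡ᵇ-yes : ∀ {A : Set} {x y : A} m n → m ≡ n → (if m ≡ᵇ n then x else y) ≡ x
  if-≡ᵇ-yes m n m≡n with m ≡ᵇ n in eq
  ... | true  = refl
  ... | false = ⊥-elim (subst T eq (≡⇒≡ᵇ m n m≡n))

  if-≡ᵇ-no : ∀ {A : Set} {x y : A} m n → m ≢ n → (if m ≡ᵇ n then x else y) ≡ y
  if-≡ᵇ-no m n m≢n with m ≡ᵇ n in eq
  ... | true  = ⊥-elim (m≢n (≡ᵇ⇒≡ m n (subst T (sym eq) _)))
  ... | false = refl

  if-≤ᵇ-yes : ∀ {A : Set} {x y : A} {m n} → m ≤ n → (if m ≤ᵇ n then x else y) ≡ x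
  if-≤ᵇ-yes {m = m} {n} m≤n with m ≤ᵇ n in eq
  ... | true  = refl
  ... | false = ⊥-elim (subst T eq (≤⇒≤ᵇ m≤n))

  if-≤ᵇ-no : ∀ {A : Set} {x y : A} {m n} → n < m → (if m ≤ᵇ n then x else y) ≡ y
  if-≤ᵇ-no {m = m} {n} n<m with m ≤ᵇ n in eq
  ... | true  = ⊥-elim (<⇒≱ n<m (≤ᵇ⇒≤ m n (subst T (sym eq) _)))
  ... | false = refl

  ∣∧<⇒≡0 : ∀ {m n} → m ∣ n → n < m → n ≡ 0
  ∣∧<⇒≡0 {n = zero}  _   _   = refl
  ∣∧<⇒≡0 {n = suc n} m∣n n<m = ⊥-elim (>⇒∤ n<m m∣n)

  ^-monoʳ-∣ : ∀ t {k j} → k ≤ j → t ^ k ∣ t ^ j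
  ^-monoʳ-∣ t {k} {j} k≤j = divides (t ^ (j ∸ k)) (begin
    t ^ j                ≡⟨ cong (t ^_) (m∸n+n≡m k≤j) ⟨
    t ^ (j ∸ k + k)      ≡⟨ ^-distribˡ-+-* t (j ∸ k) k ⟩
    t ^ (j ∸ k) * t ^ k  ∎)
    where open ≡-Reasoning

  odd⇒≡suc[h+h] : ∀ {n} → n % 2 ≡ 1 → n ≡ suc (n / 2 + n / 2)
  odd⇒≡suc[h+h] {n} n%2≡1 = begin
    n                       ≡⟨ m≡m%n+[m/n]*n n 2 ⟩
    n % 2 + n / 2 * 2       ≡⟨ cong₂ _+_ n%2≡1 (*-comm (n / 2) 2) ⟩
    suc (n / 2 + (n / 2 + 0)) ≡⟨ cong (λ k → suc (n / 2 + k)) (+-identityʳ (n / 2)) ⟩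
    suc (n / 2 + n / 2)     ∎
    where open ≡-Reasoning

  coprime-*ʳ : ∀ {m n o} → Coprime m n → Coprime m o → Coprime m (n * o)
  coprime-*ʳ m⊥n m⊥o (d∣m , d∣n*o) =
    m⊥o (d∣m , coprime-divisor (λ (c∣d , c∣n) → m⊥n (∣-trans c∣d d∣m , c∣n)) d∣n*o)

  coprime-^ʳ : ∀ {m n} → Coprime m n → ∀ k → Coprime m (n ^ k)
  coprime-^ʳ m⊥n zero    (_ , d∣1) = ∣1⇒≡1 d∣1
  coprime-^ʳ m⊥n (suc k) = coprime-*ʳ m⊥n (coprime-^ʳ m⊥n k)

  prime∤⇒coprime : ∀ {t n} → Prime t → ¬ t ∣ n → Coprime t n
  prime∤⇒coprime t-prime t∤n (d∣t , d∣n) with prime⇒irreducible t-prime d∣t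
  ... | inj₁ d≡1  = d≡1
  ... | inj₂ refl = ⊥-elim (t∤n d∣n)

  prime≥2 : ∀ {t} → Prime t → 2 ≤ t
  prime≥2 {t} t-prime = nonTrivial⇒n>1 t {{prime⇒nonTrivial t-prime}}

  distinct-primes-coprime : ∀ {t u} → Prime t → Prime u → t ≢ u → Coprime t u
  distinct-primes-coprime t-prime u-prime t≢u = prime∤⇒coprime t-prime λ t∣u →
    [ (λ t≡1 → <⇒≢ (prime≥2 t-prime) (sym t≡1)) , t≢u ]′ (prime⇒irreducible u-prime t∣u)

  prime-factor : ∀ n → 2 ≤ n → ∃[ t ] (Prime t × t ∣ n)
  prime-factor = <-rec (λ n → 2 ≤ n → ∃[ t ] (Prime t × t ∣ n)) λ n rec n≥2 → case prime? n of λ where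
    (yes n-prime) → n , n-prime , ∣-refl
    (no ¬prime) → case ¬prime⇒composite {{n>1⇒nonTrivial n≥2}} ¬prime of λ where
      (composite {d} d<n d∣n) →
        let t , t-prime , t∣d = rec d<n (nonTrivial⇒n>1 d) in t , t-prime , ∣-trans t∣d d∣n

  SeparatingPrimePower : ℕ → ℕ → Set
  SeparatingPrimePower s e = ∃₂ λ t k → Prime t × t ^ k ∣ s × ¬ t ^ k ∣ e

  -- Strong induction on s: if a prime factor t of s also divides e, separate s / t from e / t,
  -- then multiply the result by t when it is itself a power of t.
  prime-power-separating : ∀ s {e} → 1 ≤ s → ¬ s ∣ e → SeparatingPrimePower s e
  prime-power-separating = <-rec _ step
    where
    step : ∀ s → (∀ {s′} → s′ < s → ∀ {e} → 1 ≤ s′ → ¬ s′ ∣ e → SeparatingPrimePower s′ e) →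
           ∀ {e} → 1 ≤ s → ¬ s ∣ e → SeparatingPrimePower s e
    step 1 rec s≥1 s∤e = ⊥-elim (s∤e (1∣ _))
    step s@(2+ _) rec {e} s≥1 s∤e with prime-factor s (s≤s (s≤s z≤n))
    ... | t , t-prime , t∣s with t ∣? e
    ...   | no t∤e = t , 1 , t-prime , subst (_∣ s) (sym (*-identityʳ t)) t∣s , t∤e ∘ subst (_∣ e) (*-identityʳ t)
    ...   | yes t∣e
      with rec (quotient-< t∣s {{prime⇒nonTrivial t-prime}}) s′≥1 s′∤e′
      where
      instance _ = prime⇒nonZero t-prime
      s′ = quotient t∣s
      e′ = quotient t∣e
      s′≥1 : 1 ≤ s′
      s′≥1 = >-nonZero⁻¹ s′ {{quotient≢0 t∣s}}
      s′∤e′ : ¬ s′ ∣ e′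
      s′∤e′ s′∣e′ = s∤e (subst₂ _∣_ (sym (m∣n⇒n≡m*quotient t∣s)) (sym (m∣n⇒n≡m*quotient t∣e))
                                  (*-monoʳ-∣ t s′∣e′))
    ... | u , k , u-prime , uᵏ∣s′ , uᵏ∤e′ with u ≟ t
    ...   | yes refl = t , suc k , t-prime , tᵏ⁺¹∣s , tᵏ⁺¹∤e
      where
      instance _ = prime⇒nonZero t-prime
      tᵏ⁺¹∣s : t ^ suc k ∣ s
      tᵏ⁺¹∣s = subst (t ^ suc k ∣_) (sym (m∣n⇒n≡m*quotient t∣s)) (*-monoʳ-∣ t uᵏ∣s′)
      tᵏ⁺¹∤e : ¬ t ^ suc k ∣ e
      tᵏ⁺¹∤e tᵏ⁺¹∣e = uᵏ∤e′ (*-cancelˡ-∣ t (subst (t ^ suc k ∣_) (m∣n⇒n≡m*quotient t∣e) tᵏ⁺¹∣e))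
    ...   | no u≢t = u , k , u-prime , ∣-trans uᵏ∣s′ (quotient-∣ t∣s) , uᵏ∤e
      where
      uᵏ∤e : ¬ u ^ k ∣ e
      uᵏ∤e uᵏ∣e = uᵏ∤e′ (coprime-divisor uᵏ⊥t (subst (u ^ k ∣_) (m∣n⇒n≡m*quotient t∣e) uᵏ∣e))
        where uᵏ⊥t = Coprime-sym (coprime-^ʳ (distinct-primes-coprime t-prime u-prime (u≢t ∘ sym)) k)

  PowerSplit : ℕ → ℕ → Set
  PowerSplit t e = ∃₂ λ j e′ → e ≡ t ^ j * e′ × ¬ t ∣ e′

  prime-power-split : ∀ {t} → Prime t → ∀ e → .{{NonZero e}} → PowerSplit t e
  prime-power-split {t} t-prime = <-rec (λ e → .{{NonZero e}} → PowerSplit t e) step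
    where
    step : ∀ e → (∀ {e′} → e′ < e → .{{NonZero e′}} → PowerSplit t e′) → .{{NonZero e}} → PowerSplit t e
    step e rec with t ∣? e
    ... | no t∤e = 0 , e , sym (+-identityʳ e) , t∤e
    ... | yes t∣e with rec (quotient-< t∣e {{prime⇒nonTrivial t-prime}}) {{quotient≢0 t∣e}}
    ...   | j , e′ , q≡ , t∤e′ = suc j , e′ , e≡ , t∤e′
      where
      open ≡-Reasoning
      e≡ : e ≡ t ^ suc j * e′
      e≡ = begin
        e                  ≡⟨ m∣n⇒n≡m*quotient t∣e ⟩
        t * quotient t∣e   ≡⟨ cong (t *_) q≡ ⟩
        t * (t ^ j * e′)   ≡⟨ *-assoc t (t ^ j) e′ ⟨
        t ^ suc j * e′     ∎

module Paths where

  open import Data.Nat.Base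
  open import Data.Nat.Properties
  open import Data.Bool.Base using (if_then_else_)
  open import Data.Fin.Base using (Fin; toℕ)
  open import Data.List.Base using (List; _∷_; applyUpTo; length; lookup)
  open import Data.List.Properties using (length-applyUpTo; lookup-applyUpTo)
  open import Data.Fin.Properties using (toℕ-injective; toℕ<n)
  open import Data.Product using (_,_)
  open import Function using (_∘_)
  open import Relation.Binary.PropositionalEquality
  open Arithmetic using (if-≡ᵇ-yes; if-≡ᵇ-no)

  pathEdges-applyUpTo : ∀ {n} (f : ℕ → Fin n) L →
                        pathEdges (applyUpTo f (suc L)) ≡ applyUpTo (λ k → toℕ (f k) , toℕ (f (suc k))) L
  pathEdges-applyUpTo f zero    = refl
  pathEdges-applyUpTo f (suc L) = cong (_ ∷_) (pathEdges-applyUpTo (f ∘ suc) L)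

  count : (ℕ → ℕ) → ℕ → ℕ → ℕ
  count f x zero    = 0
  count f x (suc L) = (if f 0 ≡ᵇ x then 1 else 0) + count (f ∘ suc) x L

  countType-applyUpTo : ∀ n x (e : ℕ → Edge) L → countType n x (applyUpTo e L) ≡ count (etype n ∘ e) x L
  countType-applyUpTo n x e zero    = refl
  countType-applyUpTo n x e (suc L) = cong (_ +_) (countType-applyUpTo n x (e ∘ suc) L)

  count-cong : ∀ {f h} x L → (∀ {k} → k < L → f k ≡ h k) → count f x L ≡ count h x L
  count-cong x zero    f≗h = refl
  count-cong x (suc L) f≗h = cong₂ _+_ (cong (λ y → if y ≡ᵇ x then 1 else 0) (f≗h z<s)) (count-cong x L (f≗h ∘ s<s))

  count-+ : ∀ f x L₁ L₂ → count f x (L₁ + L₂) ≡ count f x L₁ + count (λ k → f (L₁ + k)) x L₂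
  count-+ f x zero     L₂ = refl
  count-+ f x (suc L₁) L₂ =
    trans (cong (hit +_) (count-+ (f ∘ suc) x L₁ L₂)) (sym (+-assoc hit (count (f ∘ suc) x L₁) _))
    where hit = if f 0 ≡ᵇ x then 1 else 0

  count≡0 : ∀ f x L → (∀ {k} → k < L → f k ≢ x) → count f x L ≡ 0
  count≡0 f x zero    _   = refl
  count≡0 f x (suc L) f≢x = cong₂ _+_ (if-≡ᵇ-no (f 0) x (f≢x z<s)) (count≡0 (f ∘ suc) x L (f≢x ∘ s<s))

  count≡1 : ∀ f x L {c} → c < L → f c ≡ x → (∀ {k} → k < L → f k ≡ x → k ≡ c) → count f x L ≡ 1
  count≡1 f x (suc L) {zero}  _       f0≡x unique =
    cong₂ _+_ (if-≡ᵇ-yes (f 0) x f0≡x) (count≡0 (f ∘ suc) x L λ k<L fk≡x → 1+n≢0 (unique (s<s k<L) fk≡x))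
  count≡1 f x (suc L) {suc c} c<L fc≡x unique =
    cong₂ _+_ (if-≡ᵇ-no (f 0) x λ f0≡x → 1+n≢0 (sym (unique z<s f0≡x)))
              (count≡1 (f ∘ suc) x L (s<s⁻¹ c<L) fc≡x λ k<L fk≡x → suc-injective (unique (s<s k<L) fk≡x))

  cd-sym : ∀ n u v → cd n u v ≡ cd n v u
  cd-sym n u v = cong (λ d → d ⊓ (n ∸ d)) (∣-∣-comm u v)

  cdE-sym : ∀ n e e′ → cdE n e e′ ≡ cdE n e′ e
  cdE-sym n e e′ = cd-sym n (start n e) (start n e′)

  -- GP3 n P unfolds to SeparatedPairs n (pathEdges P).
  SeparatedPairs : ℕ → List Edge → Set
  SeparatedPairs n es = ∀ (i j k l : Fin (length es)) →
    let E = lookup es in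
    i ≢ j → k ≢ l → i ≢ k → i ≢ l → j ≢ k → j ≢ l →
    etype n (E i) ≡ etype n (E j) →
    etype n (E k) ≡ etype n (E l) →
    etype n (E k) ≢ etype n (E i) →
    cdE n (E k) (E l) ≢ cdE n (E i) (E j)

  separatedPairs-applyUpTo : ∀ n (e : ℕ → Edge) L →
    (∀ {i j k l} → i < L → j < L → k < L → l < L → i ≢ j → k ≢ l →
     etype n (e i) ≡ etype n (e j) → etype n (e k) ≡ etype n (e l) → etype n (e k) ≢ etype n (e i) →
     cdE n (e k) (e l) ≢ cdE n (e i) (e j)) →
    SeparatedPairs n (applyUpTo e L)
  separatedPairs-applyUpTo n e L separated i j k l i≢j k≢l _ _ _ _
    rewrite lookup-applyUpTo e L i | lookup-applyUpTo e L j | lookup-applyUpTo e L k | lookup-applyUpTo e L l =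
    separated (bound i) (bound j) (bound k) (bound l) (i≢j ∘ toℕ-injective) (k≢l ∘ toℕ-injective)
    where
    bound : (x : Fin (length (applyUpTo e L))) → toℕ x < L
    bound x = subst (toℕ x <_) (length-applyUpTo e L) (toℕ<n x)

module Modular (p : ℕ) (p-prime : Prime p) where

  open import Data.Nat.Base as ℕ using (zero; suc; NonZero; _⊓_)
  import Data.Nat.Properties as ℕₚ
  import Data.Nat.Divisibility as ℕ∣
  open import Data.Nat.Primality using (euclidsLemma; prime⇒nonZero; prime⇒nonTrivial)
  open import Data.Integer.Base using (ℤ; +_; 0ℤ; 1ℤ; -1ℤ; _+_; _*_; _-_; -_; _^_; ∣_∣; _%ℕ_; _/ℕ_)
  import Data.Integer.Properties as ℤₚ
  open import Data.Integer.Divisibility.Signed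
  open import Data.Integer.DivMod using (n%ℕd<d; a≡a%ℕn+[a/ℕn]*n)
  open import Data.Integer.Tactic.RingSolver using (solve-∀)
  open import Data.Fin.Base as Fin using (Fin; toℕ; fromℕ<)
  import Data.Fin.Properties as Finₚ
  open import Data.Sum.Base using (_⊎_; inj₁; inj₂)
  open import Data.Product using (∃₂; _×_; _,_)
  open import Data.Empty using (⊥-elim)
  open import Function using (_∘_)
  open import Relation.Nullary using (¬_; Dec; yes; no; map′)
  open import Relation.Binary.Bundles using (Setoid)
  import Relation.Binary.Reasoning.Setoid
  open import Relation.Binary.PropositionalEquality
  open Arithmetic using (∣∧<⇒≡0; if-≤ᵇ-yes; if-≤ᵇ-no)

  infix 4 _≋_ _≉_ _≋?_

  -- A record rather than + p ∣ a - b, so that a and b can be inferred from a proof.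
  record _≋_ (a b : ℤ) : Set where
    constructor mk≋
    field p∣a-b : + p ∣ a - b

  _≉_ : ℤ → ℤ → Set
  a ≉ b = ¬ a ≋ b

  ≋-refl : ∀ {a} → a ≋ a
  ≋-refl {a} = mk≋ (divides 0ℤ (ℤₚ.+-inverseʳ a))

  ≡⇒≋ : ∀ {a b} → a ≡ b → a ≋ b
  ≡⇒≋ refl = ≋-refl

  ≋-sym : ∀ {a b} → a ≋ b → b ≋ a
  ≋-sym {a} {b} (mk≋ p∣a-b) = mk≋ (subst (+ p ∣_) (identity a b) (∣m⇒∣-m p∣a-b))
    where identity : ∀ a b → - (a - b) ≡ b - a
          identity = solve-∀

  ≋-trans : ∀ {a b c} → a ≋ b → b ≋ c → a ≋ c
  ≋-trans {a} {b} {c} (mk≋ p∣a-b) (mk≋ p∣b-c) = mk≋ (subst (+ p ∣_) (identity a b c) (∣m∣n⇒∣m+n p∣a-b p∣b-c))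
    where identity : ∀ a b c → (a - b) + (b - c) ≡ a - c
          identity = solve-∀

  ≋-setoid : Setoid _ _
  ≋-setoid = record { Carrier = ℤ ; _≈_ = _≋_
                    ; isEquivalence = record { refl = ≋-refl ; sym = ≋-sym ; trans = ≋-trans } }

  module ≋-Reasoning = Relation.Binary.Reasoning.Setoid ≋-setoid

  +-cong : ∀ {a b c d} → a ≋ b → c ≋ d → a + c ≋ b + d
  +-cong {a} {b} {c} {d} (mk≋ p∣a-b) (mk≋ p∣c-d) = mk≋ (subst (+ p ∣_) (identity a b c d) (∣m∣n⇒∣m+n p∣a-b p∣c-d))
    where identity : ∀ a b c d → (a - b) + (c - d) ≡ (a + c) - (b + d)
          identity = solve-∀

  -‿cong : ∀ {a b} → a ≋ b → - a ≋ - b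
  -‿cong {a} {b} (mk≋ p∣a-b) = mk≋ (subst (+ p ∣_) (identity a b) (∣m⇒∣-m p∣a-b))
    where identity : ∀ a b → - (a - b) ≡ - a - - b
          identity = solve-∀

  *-cong : ∀ {a b c d} → a ≋ b → c ≋ d → a * c ≋ b * d
  *-cong {a} {b} {c} {d} (mk≋ p∣a-b) (mk≋ p∣c-d) =
    mk≋ (subst (+ p ∣_) (identity a b c d) (∣m∣n⇒∣m+n (∣m⇒∣m*n c p∣a-b) (∣n⇒∣m*n b p∣c-d)))
    where identity : ∀ a b c d → (a - b) * c + b * (c - d) ≡ a * c - b * d
          identity = solve-∀

  ^-cong : ∀ {a b} n → a ≋ b → a ^ n ≋ b ^ n
  ^-cong zero    a≋b = ≋-refl
  ^-cong (suc n) a≋b = *-cong a≋b (^-cong n a≋b)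

  p≋0 : + p ≋ 0ℤ
  p≋0 = mk≋ (subst (+ p ∣_) (sym (ℤₚ.+-identityʳ (+ p))) ∣-refl)

  ≋0⇒∣ : ∀ {a} → a ≋ 0ℤ → + p ∣ a
  ≋0⇒∣ {a} (mk≋ p∣a-0) = subst (+ p ∣_) (ℤₚ.+-identityʳ a) p∣a-0

  ∣⇒≋0 : ∀ {a} → + p ∣ a → a ≋ 0ℤ
  ∣⇒≋0 {a} p∣a = mk≋ (subst (+ p ∣_) (sym (ℤₚ.+-identityʳ a)) p∣a)

  -≋0⇒≋ : ∀ {a b} → a - b ≋ 0ℤ → a ≋ b
  -≋0⇒≋ = mk≋ ∘ ≋0⇒∣

  +≋0⇒≋- : ∀ {a b} → a + b ≋ 0ℤ → a ≋ - b
  +≋0⇒≋- {a} {b} a+b≋0 = begin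
    a              ≡⟨ identity a b ⟩
    (a + b) - b    ≈⟨ +-cong a+b≋0 (≋-refl { - b }) ⟩
    0ℤ - b         ≡⟨ ℤₚ.+-identityˡ (- b) ⟩
    - b            ∎
    where
    open ≋-Reasoning
    identity : ∀ a b → a ≡ (a + b) - b
    identity = solve-∀

  _≋?_ : ∀ a b → Dec (a ≋ b)
  a ≋? b = map′ mk≋ _≋_.p∣a-b (+ p ∣? (a - b))

  *≋0⇒≋0 : ∀ {a b} → a * b ≋ 0ℤ → a ≋ 0ℤ ⊎ b ≋ 0ℤ
  *≋0⇒≋0 {a} {b} ab≋0
    with euclidsLemma ∣ a ∣ ∣ b ∣ p-prime (subst (p ℕ∣.∣_) (ℤₚ.abs-* a b) (∣⇒∣ᵤ (≋0⇒∣ ab≋0)))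
  ... | inj₁ p∣a = inj₁ (∣⇒≋0 (∣ᵤ⇒∣ p∣a))
  ... | inj₂ p∣b = inj₂ (∣⇒≋0 (∣ᵤ⇒∣ p∣b))

  *-≉0 : ∀ {a b} → a ≉ 0ℤ → b ≉ 0ℤ → a * b ≉ 0ℤ
  *-≉0 a≉0 b≉0 ab≋0 with *≋0⇒≋0 ab≋0
  ... | inj₁ a≋0 = a≉0 a≋0
  ... | inj₂ b≋0 = b≉0 b≋0

  *-cancelˡ : ∀ {a b c} → a ≉ 0ℤ → a * b ≋ a * c → b ≋ c
  *-cancelˡ {a} {b} {c} a≉0 (mk≋ p∣ab-ac) with *≋0⇒≋0 (∣⇒≋0 (subst (+ p ∣_) (identity a b c) p∣ab-ac))
    where identity : ∀ a b c → a * b - a * c ≡ a * (b - c)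
          identity = solve-∀
  ... | inj₁ a≋0 = ⊥-elim (a≉0 a≋0)
  ... | inj₂ b-c≋0 = -≋0⇒≋ b-c≋0

  *-cancelʳ : ∀ {a b c} → c ≉ 0ℤ → a * c ≋ b * c → a ≋ b
  *-cancelʳ {a} {b} {c} c≉0 ac≋bc =
    *-cancelˡ c≉0 (≋-trans (≡⇒≋ (ℤₚ.*-comm c a)) (≋-trans ac≋bc (≡⇒≋ (ℤₚ.*-comm b c))))

  pos-∸ : ∀ {m n} → n ℕ.≤ m → + m - + n ≡ + (m ℕ.∸ n)
  pos-∸ {m} {n} n≤m = trans (ℤₚ.m-n≡m⊖n m n) (ℤₚ.⊖-≥ n≤m)

  p>1 : 1 ℕ.< p
  p>1 = ℕ.nonTrivial⇒n>1 p {{prime⇒nonTrivial p-prime}}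

  p>0 : 0 ℕ.< p
  p>0 = ℕₚ.<-trans ℕ.z<s p>1

  ≋⇒≡-≥ : ∀ {m n} → n ℕ.≤ m → m ℕ.< p → + m ≋ + n → m ≡ n
  ≋⇒≡-≥ {m} {n} n≤m m<p (mk≋ p∣m-n) = ℕₚ.≤-antisym (ℕₚ.m∸n≡0⇒m≤n m∸n≡0) n≤m
    where
    p∣m∸n : p ℕ∣.∣ m ℕ.∸ n
    p∣m∸n = ∣⇒∣ᵤ (subst (+ p ∣_) (pos-∸ n≤m) p∣m-n)
    m∸n≡0 : m ℕ.∸ n ≡ 0
    m∸n≡0 = ∣∧<⇒≡0 p∣m∸n (ℕₚ.≤-<-trans (ℕₚ.m∸n≤m m n) m<p)

  ≋⇒≡ : ∀ {m n} → m ℕ.< p → n ℕ.< p → + m ≋ + n → m ≡ n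
  ≋⇒≡ {m} {n} m<p n<p m≋n with ℕₚ.≤-total n m
  ... | inj₁ n≤m = ≋⇒≡-≥ n≤m m<p m≋n
  ... | inj₂ m≤n = sym (≋⇒≡-≥ m≤n n<p (≋-sym m≋n))

  1≉0 : 1ℤ ≉ 0ℤ
  1≉0 1≋0 with ≋⇒≡ p>1 p>0 1≋0
  ... | ()

  instance
    p≢0 : NonZero p
    p≢0 = prime⇒nonZero p-prime

  -- Abstract: otherwise conversion checking unfolds the integer division and runs out of memory.
  abstract
    residue : ℤ → ℕ
    residue a = a %ℕ p

    residue<p : ∀ a → residue a ℕ.< p
    residue<p a = n%ℕd<d a p

    residue≋ : ∀ a → + residue a ≋ a
    residue≋ a = ≋-sym (mk≋ (divides (a /ℕ p) (a-r≡q*p (a≡a%ℕn+[a/ℕn]*n a p))))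
      where
      a-r≡q*p : a ≡ + residue a + (a /ℕ p) * + p → a - + residue a ≡ (a /ℕ p) * + p
      a-r≡q*p eq = trans (cong (_- + residue a) eq) (identity (+ residue a) (a /ℕ p) (+ p))
        where identity : ∀ r q p → (r + q * p) - r ≡ q * p
              identity = solve-∀

  residue-cong : ∀ {a b} → a ≋ b → residue a ≡ residue b
  residue-cong {a} {b} a≋b =
    ≋⇒≡ (residue<p a) (residue<p b) (≋-trans (residue≋ a) (≋-trans a≋b (≋-sym (residue≋ b))))

  residue-injective : ∀ {a b} → residue a ≡ residue b → a ≋ b
  residue-injective {a} {b} eq = ≋-trans (≋-sym (residue≋ a)) (≋-trans (≡⇒≋ (cong +_ eq)) (residue≋ b))

  residue-pos : ∀ {n} → n ℕ.< p → residue (+ n) ≡ n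
  residue-pos {n} n<p = ≋⇒≡ (residue<p (+ n)) n<p (residue≋ (+ n))

  residue>0 : ∀ {a} → a ≉ 0ℤ → 0 ℕ.< residue a
  residue>0 {a} a≉0 = ℕₚ.n≢0⇒n>0 λ r≡0 → a≉0 (≋-trans (≋-sym (residue≋ a)) (≡⇒≋ (cong +_ r≡0)))

  collision : ∀ N (f : ℕ → ℤ) → p ℕ.∸ 1 ℕ.< N → (∀ {i} → i ℕ.< N → f i ≉ 0ℤ) →
              ∃₂ λ i j → i ℕ.< j × j ℕ.< N × f i ≋ f j
  collision N f N>p-1 f≉0 = from (Finₚ.pigeonhole N>p-1 slot)
    where
    slot : Fin N → Fin (p ℕ.∸ 1)
    slot i = fromℕ< (ℕₚ.∸-monoˡ-< (residue<p (f (toℕ i))) (residue>0 (f≉0 (Finₚ.toℕ<n i))))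
    toℕ-slot : ∀ i → toℕ (slot i) ≡ residue (f (toℕ i)) ℕ.∸ 1
    toℕ-slot i = Finₚ.toℕ-fromℕ< _
    pred-injective : ∀ {x y} → 0 ℕ.< x → 0 ℕ.< y → x ℕ.∸ 1 ≡ y ℕ.∸ 1 → x ≡ y
    pred-injective {suc x} {suc y} _ _ = cong suc
    from : (∃₂ λ i j → i Fin.< j × slot i ≡ slot j) → ∃₂ λ i j → i ℕ.< j × j ℕ.< N × f i ≋ f j
    from (i , j , i<j , slotᵢ≡slotⱼ) = toℕ i , toℕ j , i<j , Finₚ.toℕ<n j , residue-injective rᵢ≡rⱼ
      where
      rᵢ≡rⱼ : residue (f (toℕ i)) ≡ residue (f (toℕ j))
      rᵢ≡rⱼ = pred-injective (residue>0 (f≉0 (Finₚ.toℕ<n i))) (residue>0 (f≉0 (Finₚ.toℕ<n j)))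
                (trans (sym (toℕ-slot i)) (trans (cong toℕ slotᵢ≡slotⱼ) (toℕ-slot j)))

  incongruent-nonzero-bound : ∀ N (f : ℕ → ℤ) → (∀ {i j} → i ℕ.< j → j ℕ.< N → f i ≉ f j) →
                              (∀ {i} → i ℕ.< N → f i ≉ 0ℤ) → N ℕ.≤ p ℕ.∸ 1
  incongruent-nonzero-bound N f distinct f≉0 = ℕₚ.≮⇒≥ λ p-1<N →
    let i , j , i<j , j<N , fᵢ≋fⱼ = collision N f p-1<N f≉0 in distinct i<j j<N fᵢ≋fⱼ

  p∸1<p : p ℕ.∸ 1 ℕ.< p
  p∸1<p = ℕₚ.∸-monoʳ-< ℕ.z<s (ℕₚ.<⇒≤ p>1)

  infix 4 _≋±_

  _≋±_ : ℤ → ℤ → Set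
  a ≋± b = a ≋ b ⊎ a ≋ - b

  -‿flip : ∀ {a b} → - a ≋ b → a ≋ - b
  -‿flip {a} -a≋b = ≋-trans (≡⇒≋ (sym (ℤₚ.neg-involutive a))) (-‿cong -a≋b)

  ≋±-via : ∀ {x a b} → x ≋± a → x ≋± b → a ≋± b
  ≋±-via (inj₁ x≋a)  (inj₁ x≋b)  = inj₁ (≋-trans (≋-sym x≋a) x≋b)
  ≋±-via (inj₁ x≋a)  (inj₂ x≋-b) = inj₂ (≋-trans (≋-sym x≋a) x≋-b)
  ≋±-via (inj₂ x≋-a) (inj₁ x≋b)  = inj₂ (-‿flip (≋-trans (≋-sym x≋-a) x≋b))
  ≋±-via (inj₂ x≋-a) (inj₂ x≋-b) =
    inj₁ (≋-trans (-‿flip (≋-trans (≋-sym x≋-a) x≋-b)) (≡⇒≋ (ℤₚ.neg-involutive _)))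

  ‖_‖ : ℤ → ℕ
  ‖ a ‖ = residue a ⊓ residue (- a)

  ‖‖-cong : ∀ {a b} → a ≋ b → ‖ a ‖ ≡ ‖ b ‖
  ‖‖-cong a≋b = cong₂ _⊓_ (residue-cong a≋b) (residue-cong (-‿cong a≋b))

  ‖-‖ : ∀ a → ‖ - a ‖ ≡ ‖ a ‖
  ‖-‖ a = trans (cong (residue (- a) ⊓_) (cong residue (ℤₚ.neg-involutive a))) (ℕₚ.⊓-comm _ _)

  ‖‖-cong± : ∀ {a b} → a ≋± b → ‖ a ‖ ≡ ‖ b ‖
  ‖‖-cong± (inj₁ a≋b)  = ‖‖-cong a≋b
  ‖‖-cong± (inj₂ a≋-b) = trans (‖‖-cong a≋-b) (‖-‖ _)

  ‖‖-sel : ∀ a → + ‖ a ‖ ≋± a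
  ‖‖-sel a with ℕₚ.⊓-sel (residue a) (residue (- a))
  ... | inj₁ ‖a‖≡r = inj₁ (≋-trans (≡⇒≋ (cong +_ ‖a‖≡r)) (residue≋ a))
  ... | inj₂ ‖a‖≡r = inj₂ (≋-trans (≡⇒≋ (cong +_ ‖a‖≡r)) (residue≋ (- a)))

  ‖‖-injective : ∀ {a b} → ‖ a ‖ ≡ ‖ b ‖ → a ≋± b
  ‖‖-injective {a} {b} ‖a‖≡‖b‖ = ≋±-via (‖‖-sel a) (subst (λ k → + k ≋± b) (sym ‖a‖≡‖b‖) (‖‖-sel b))

  residue-neg : ∀ {a} → a ≉ 0ℤ → residue (- a) ≡ p ℕ.∸ residue a
  residue-neg {a} a≉0 = sym (trans (sym (residue-pos p∸r<p)) (residue-cong p∸r≋-a))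
    where
    open ≋-Reasoning
    r = residue a
    p∸r<p : p ℕ.∸ r ℕ.< p
    p∸r<p = ℕₚ.∸-monoʳ-< (residue>0 a≉0) (ℕₚ.<⇒≤ (residue<p a))
    p∸r≋-a : + (p ℕ.∸ r) ≋ - a
    p∸r≋-a = begin
      + (p ℕ.∸ r)    ≡⟨ pos-∸ (ℕₚ.<⇒≤ (residue<p a)) ⟨
      + p - + r      ≈⟨ +-cong p≋0 (-‿cong (residue≋ a)) ⟩
      0ℤ - a         ≡⟨ ℤₚ.+-identityˡ (- a) ⟩
      - a            ∎

  ‖‖≡ : ∀ a → ‖ a ‖ ≡ residue a ⊓ (p ℕ.∸ residue a)
  ‖‖≡ a with a ≋? 0ℤ
  ... | no a≉0  = cong (residue a ⊓_) (residue-neg a≉0)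
  ... | yes a≋0 rewrite residue-cong a≋0 | residue-cong (-‿cong a≋0) | residue-pos p>0 = refl

  ‖‖≤p∸residue : ∀ a → ‖ a ‖ ℕ.≤ p ℕ.∸ residue a
  ‖‖≤p∸residue a = ℕₚ.≤-trans (ℕₚ.≤-reflexive (‖‖≡ a)) (ℕₚ.m⊓n≤n _ _)

  ‖‖>0 : ∀ {a} → a ≉ 0ℤ → 0 ℕ.< ‖ a ‖
  ‖‖>0 a≉0 = ℕₚ.⊓-glb (residue>0 a≉0) (residue>0 (a≉0 ∘ -‿flip))

  pos-residue : ∀ {u v} → v ℕ.≤ u → u ℕ.< p → residue (+ u - + v) ≡ u ℕ.∸ v
  pos-residue {u} {v} v≤u u<p = trans (cong residue (pos-∸ v≤u)) (residue-pos (ℕₚ.≤-<-trans (ℕₚ.m∸n≤m u v) u<p))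

  cd≡‖-‖-≥ : ∀ {u v} → v ℕ.≤ u → u ℕ.< p → cd p u v ≡ ‖ + u - + v ‖
  cd≡‖-‖-≥ {u} {v} v≤u u<p = begin
    cd p u v                        ≡⟨ cong (λ d → d ⊓ (p ℕ.∸ d)) ∣u-v∣≡residue ⟩
    residue d ⊓ (p ℕ.∸ residue d)   ≡⟨ ‖‖≡ d ⟨
    ‖ d ‖                           ∎
    where
    open ≡-Reasoning
    d = + u - + v
    ∣u-v∣≡residue : ℕ.∣ u - v ∣ ≡ residue d
    ∣u-v∣≡residue = trans (ℕₚ.m≤n⇒∣n-m∣≡n∸m v≤u) (sym (pos-residue v≤u u<p))

  cd≡‖-‖ : ∀ {u v} → u ℕ.< p → v ℕ.< p → cd p u v ≡ ‖ + u - + v ‖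
  cd≡‖-‖ {u} {v} u<p v<p with ℕₚ.≤-total v u
  ... | inj₁ v≤u = cd≡‖-‖-≥ v≤u u<p
  ... | inj₂ u≤v = begin
    cd p u v             ≡⟨ cong (λ d → d ⊓ (p ℕ.∸ d)) (ℕₚ.∣-∣-comm u v) ⟩
    cd p v u             ≡⟨ cd≡‖-‖-≥ u≤v v<p ⟩
    ‖ + v - + u ‖        ≡⟨ ‖‖-cong (≡⇒≋ (identity (+ u) (+ v))) ⟩
    ‖ - (+ u - + v) ‖    ≡⟨ ‖-‖ (+ u - + v) ⟩
    ‖ + u - + v ‖        ∎
    where
    open ≡-Reasoning
    identity : ∀ a b → b - a ≡ - (a - b)
    identity = solve-∀

  diffMod≡residue : ∀ {u v} → u ℕ.< p → v ℕ.< p → diffMod p u v ≡ residue (+ v - + u)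
  diffMod≡residue {u} {v} u<p v<p with u ℕₚ.≤? v
  ... | yes u≤v = trans (if-≤ᵇ-yes u≤v) (sym (pos-residue u≤v v<p))
  ... | no u≰v  = trans (if-≤ᵇ-no v<u) (sym (trans (residue-cong (≋-sym wrapped≋)) (residue-pos wrapped<p)))
    where
    open ≋-Reasoning
    v<u = ℕₚ.≰⇒> u≰v
    u≤v+p : u ℕ.≤ v ℕ.+ p
    u≤v+p = ℕₚ.≤-trans (ℕₚ.<⇒≤ u<p) (ℕₚ.m≤n+m p v)
    wrapped<p : v ℕ.+ p ℕ.∸ u ℕ.< p
    wrapped<p = subst (v ℕ.+ p ℕ.∸ u ℕ.<_) (ℕₚ.m+n∸m≡n u p) (ℕₚ.∸-monoˡ-< (ℕₚ.+-monoˡ-< p v<u) u≤v+p)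
    wrapped≋ : + (v ℕ.+ p ℕ.∸ u) ≋ + v - + u
    wrapped≋ = begin
      + (v ℕ.+ p ℕ.∸ u)      ≡⟨ pos-∸ u≤v+p ⟨
      + (v ℕ.+ p) - + u      ≡⟨ cong (_- + u) (ℤₚ.pos-+ v p) ⟩
      (+ v + + p) - + u      ≈⟨ +-cong (+-cong (≋-refl {+ v}) p≋0) (≋-refl { - + u }) ⟩
      (+ v + 0ℤ) - + u       ≡⟨ cong (_- + u) (ℤₚ.+-identityʳ (+ v)) ⟩
      + v - + u              ∎

  cd≡‖diff‖ : ∀ {u v} → u ℕ.< p → v ℕ.< p → cd p u v ≡ ‖ + v - + u ‖
  cd≡‖diff‖ {u} {v} u<p v<p =
    trans (cd≡‖-‖ u<p v<p) (trans (sym (‖-‖ (+ u - + v))) (‖‖-cong (≡⇒≋ (identity (+ u) (+ v)))))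
    where identity : ∀ a b → - (a - b) ≡ b - a
          identity = solve-∀

  ≋±-*-congʳ : ∀ {a b} c → a ≋± b → a * c ≋± b * c
  ≋±-*-congʳ c (inj₁ a≋b)  = inj₁ (*-cong a≋b (≋-refl {c}))
  ≋±-*-congʳ {b = b} c (inj₂ a≋-b) =
    inj₂ (≋-trans (*-cong a≋-b (≋-refl {c})) (≡⇒≋ (sym (ℤₚ.neg-distribˡ-* b c))))

  ≋±-*-cancelʳ : ∀ {a b c} → c ≉ 0ℤ → a * c ≋± b * c → a ≋± b
  ≋±-*-cancelʳ c≉0 (inj₁ ac≋bc)  = inj₁ (*-cancelʳ c≉0 ac≋bc)
  ≋±-*-cancelʳ {b = b} {c} c≉0 (inj₂ ac≋-bc) =
    inj₂ (*-cancelʳ c≉0 (≋-trans ac≋-bc (≡⇒≋ (ℤₚ.neg-distribˡ-* b c))))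

  *-self≋1⇒≋±1 : ∀ {a} → a * a ≋ 1ℤ → a ≋± 1ℤ
  *-self≋1⇒≋±1 {a} a²≋1 with *≋0⇒≋0 product≋0
    where
    open ≋-Reasoning
    identity : ∀ a → (a - 1ℤ) * (a + 1ℤ) ≡ a * a - 1ℤ
    identity = solve-∀
    product≋0 : (a - 1ℤ) * (a + 1ℤ) ≋ 0ℤ
    product≋0 = begin
      (a - 1ℤ) * (a + 1ℤ)    ≡⟨ identity a ⟩
      a * a - 1ℤ             ≈⟨ +-cong a²≋1 (≋-refl { -1ℤ }) ⟩
      0ℤ                     ∎
  ... | inj₁ a-1≋0 = inj₁ (-≋0⇒≋ a-1≋0)
  ... | inj₂ a+1≋0 = inj₂ (+≋0⇒≋- a+1≋0)

module PrimitiveRoot (p : ℕ) (p-prime : Prime p) where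

  open import Data.Nat.Base as ℕ using (zero; suc; z≤n; s≤s)
  import Data.Nat.Properties as ℕₚ
  import Data.Nat.Divisibility as ℕ∣
  import Data.Nat.DivMod as ℕ÷
  open import Data.Nat.Induction using (<-rec)
  open import Data.Nat.Coprimality using (Coprime; coprime-divisor) renaming (sym to Coprime-sym)
  open import Data.Integer.Base using (ℤ; +_; 0ℤ; 1ℤ; -1ℤ; _+_; _*_; _-_; -_; _^_)
  import Data.Integer.Properties as ℤₚ
  open import Data.Integer.Tactic.RingSolver using (solve-∀)
  open import Data.Vec.Base using (Vec; []; _∷_; replicate)
  open import Data.List.Base using ([]; _∷_; length; applyUpTo)
  open import Data.List.Properties using (length-applyUpTo)
  open import Data.List.Relation.Unary.All as All using (All; []; _∷_)
  open import Data.List.Relation.Unary.AllPairs using (AllPairs; []; _∷_)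
  import Data.List.Relation.Unary.All.Properties as Allₚ
  import Data.List.Relation.Unary.AllPairs.Properties as AllPairsₚ
  open import Data.Sum.Base using (_⊎_; inj₁; inj₂)
  open import Data.Product using (∃₂; ∃-syntax; _×_; _,_)
  open import Data.Empty using (⊥-elim)
  open import Function using (_∘_)
  open import Relation.Nullary using (¬_; Dec; yes; no; _×-dec_; ¬?)
  open import Relation.Nullary.Decidable using (decidable-stable)
  open import Relation.Binary.PropositionalEquality
  open Arithmetic
  open Modular p p-prime

  -- A monic polynomial of degree d is given by its lower coefficients c₀ ∷ … ∷ c_{d-1}.
  monic : ∀ {d} → Vec ℤ d → ℤ → ℤ
  monic []       x = 1ℤ
  monic (c ∷ cs) x = c + x * monic cs x

  divideBy : ∀ {d} → ℤ → Vec ℤ (suc d) → Vec ℤ d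
  divideBy a (c ∷ [])     = []
  divideBy a (c ∷ c′ ∷ cs) = monic (c′ ∷ cs) a ∷ divideBy a (c′ ∷ cs)

  monic-divideBy : ∀ {d} a (f : Vec ℤ (suc d)) x → monic f x ≡ (x - a) * monic (divideBy a f) x + monic f a
  monic-divideBy a (c ∷ []) x = identity c a x
    where identity : ∀ c a x → c + x * 1ℤ ≡ (x - a) * 1ℤ + (c + a * 1ℤ)
          identity = solve-∀
  monic-divideBy a (c ∷ c′ ∷ cs) x rewrite monic-divideBy a (c′ ∷ cs) x =
    identity c a x (monic (c′ ∷ cs) a) (monic (divideBy a (c′ ∷ cs)) x)
    where identity : ∀ c a x fa q → c + x * ((x - a) * q + fa) ≡ (x - a) * (fa + x * q) + (c + a * fa)
          identity = solve-∀

  IsRoot : ∀ {d} → Vec ℤ d → ℤ → Set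
  IsRoot f r = monic f r ≋ 0ℤ

  root-divideBy : ∀ {d} {a b} (f : Vec ℤ (suc d)) → IsRoot f a → IsRoot f b → b ≉ a → IsRoot (divideBy a f) b
  root-divideBy {a = a} {b} f fa≋0 fb≋0 b≉a with *≋0⇒≋0 product≋0
    where
    open ≋-Reasoning
    q = monic (divideBy a f) b
    product≋0 : (b - a) * q ≋ 0ℤ
    product≋0 = begin
      (b - a) * q                  ≡⟨ ℤₚ.+-identityʳ _ ⟨
      (b - a) * q + 0ℤ             ≈⟨ +-cong (≋-refl {(b - a) * q}) (≋-sym fa≋0) ⟩
      (b - a) * q + monic f a      ≡⟨ monic-divideBy a f b ⟨
      monic f b                    ≈⟨ fb≋0 ⟩
      0ℤ                           ∎
  ... | inj₁ b-a≋0 = ⊥-elim (b≉a (-≋0⇒≋ b-a≋0))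
  ... | inj₂ q≋0   = q≋0

  root-bound : ∀ {d} (f : Vec ℤ d) {rs} → AllPairs _≉_ rs → All (IsRoot f) rs → length rs ℕ.≤ d
  root-bound f          {[]}     _              _               = z≤n
  root-bound []         {r ∷ rs} _              (1≋0 ∷ _)       = ⊥-elim (1≉0 1≋0)
  root-bound f@(_ ∷ _)  {r ∷ rs} (r≉rs ∷ rs-distinct) (fr≋0 ∷ frs≋0) =
    s≤s (root-bound (divideBy r f) rs-distinct
          (All.zipWith (λ (fs≋0 , r≉s) → root-divideBy f fr≋0 fs≋0 (r≉s ∘ ≋-sym)) (frs≋0 , r≉rs)))

  monic-zeros : ∀ e x → monic (replicate e 0ℤ) x ≡ x ^ e
  monic-zeros zero    x = refl
  monic-zeros (suc e) x = trans (ℤₚ.+-identityˡ _) (cong (x *_) (monic-zeros e x))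

  power-root-bound : ∀ e {rs} → AllPairs _≉_ rs → All (λ r → r ^ suc e ≋ 1ℤ) rs → length rs ℕ.≤ suc e
  power-root-bound e distinct roots = root-bound (-1ℤ ∷ replicate e 0ℤ) distinct (All.map (λ {x} → root {x}) roots)
    where
    root : ∀ {r} → r ^ suc e ≋ 1ℤ → IsRoot (-1ℤ ∷ replicate e 0ℤ) r
    root {r} rᵉ⁺¹≋1 = +-cong (≋-refl { -1ℤ }) (≋-trans (≡⇒≋ (cong (r *_) (monic-zeros e r))) rᵉ⁺¹≋1)

  ^≋1⇒≉0 : ∀ {a n} → 0 ℕ.< n → a ^ n ≋ 1ℤ → a ≉ 0ℤ
  ^≋1⇒≉0 {a} {suc n} _ aⁿ≋1 a≋0 = 1≉0 (≋-trans (≋-sym aⁿ≋1) (*-cong a≋0 (≋-refl {a ^ n})))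

  ^-distrib-* : ∀ a b n → (a * b) ^ n ≡ a ^ n * b ^ n
  ^-distrib-* a b zero    = refl
  ^-distrib-* a b (suc n) = trans (cong (a * b *_) (^-distrib-* a b n)) (identity a b (a ^ n) (b ^ n))
    where identity : ∀ a b x y → a * b * (x * y) ≡ a * x * (b * y)
          identity = solve-∀

  ^-≉0 : ∀ {a} n → a ≉ 0ℤ → a ^ n ≉ 0ℤ
  ^-≉0 zero    a≉0 = 1≉0
  ^-≉0 (suc n) a≉0 = *-≉0 a≉0 (^-≉0 n a≉0)

  ^-*≋1 : ∀ {a} m n → a ^ m ≋ 1ℤ → a ^ (m ℕ.* n) ≋ 1ℤ
  ^-*≋1 {a} m n aᵐ≋1 = begin
    a ^ (m ℕ.* n)   ≡⟨ ℤₚ.^-*-assoc a m n ⟨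
    (a ^ m) ^ n     ≈⟨ ^-cong n aᵐ≋1 ⟩
    1ℤ ^ n          ≡⟨ ℤₚ.^-zeroˡ n ⟩
    1ℤ              ∎
    where open ≋-Reasoning

  ^-*≋1ʳ : ∀ {a} m n → a ^ n ≋ 1ℤ → a ^ (m ℕ.* n) ≋ 1ℤ
  ^-*≋1ʳ {a} m n aⁿ≋1 = ≋-trans (≡⇒≋ (cong (a ^_) (ℕₚ.*-comm m n))) (^-*≋1 n m aⁿ≋1)

  ^-+-cancelˡ : ∀ {a} i k → a ≉ 0ℤ → a ^ i ≋ a ^ (i ℕ.+ k) → a ^ k ≋ 1ℤ
  ^-+-cancelˡ {a} i k a≉0 aⁱ≋aⁱ⁺ᵏ = ≋-sym (*-cancelˡ (^-≉0 i a≉0) (begin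
    a ^ i * 1ℤ        ≡⟨ ℤₚ.*-identityʳ (a ^ i) ⟩
    a ^ i             ≈⟨ aⁱ≋aⁱ⁺ᵏ ⟩
    a ^ (i ℕ.+ k)     ≡⟨ ℤₚ.^-distribˡ-+-* a i k ⟩
    a ^ i * a ^ k     ∎))
    where open ≋-Reasoning

  ^≋^⇒^∸≋1 : ∀ {a i j} → a ≉ 0ℤ → i ℕ.≤ j → a ^ i ≋ a ^ j → a ^ (j ℕ.∸ i) ≋ 1ℤ
  ^≋^⇒^∸≋1 {a} {i} {j} a≉0 i≤j aⁱ≋aʲ =
    ^-+-cancelˡ i (j ℕ.∸ i) a≉0 (≋-trans aⁱ≋aʲ (≡⇒≋ (cong (a ^_) (sym (ℕₚ.m+[n∸m]≡n i≤j)))))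

  record HasOrder (a : ℤ) (r : ℕ) : Set where
    field
      order>0  : 0 ℕ.< r
      ^order≋1 : a ^ r ≋ 1ℤ
      order∣   : ∀ {n} → a ^ n ≋ 1ℤ → r ℕ∣.∣ n

  open HasOrder public

  order⇒≉0 : ∀ {a r} → HasOrder a r → a ≉ 0ℤ
  order⇒≉0 ord = ^≋1⇒≉0 (order>0 ord) (^order≋1 ord)

  order-minimal : ∀ {a r} → 0 ℕ.< r → a ^ r ≋ 1ℤ → (∀ {k} → k ℕ.< r → ¬ (0 ℕ.< k × a ^ k ≋ 1ℤ)) →
                  HasOrder a r
  order-minimal {a} {r} r>0 aʳ≋1 minimality = record { order>0 = r>0 ; ^order≋1 = aʳ≋1 ; order∣ = r∣ }
    where
    instance _ = ℕ.>-nonZero r>0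
    r∣ : ∀ {n} → a ^ n ≋ 1ℤ → r ℕ∣.∣ n
    r∣ {n} aⁿ≋1 with n ℕ÷.% r in n%r≡
    ... | zero  = ℕ∣.m%n≡0⇒n∣m n r n%r≡
    ... | suc k =
      ⊥-elim (minimality (subst (ℕ._< r) n%r≡ (ℕ÷.m%n<n n r)) (ℕ.z<s , subst (λ k → a ^ k ≋ 1ℤ) n%r≡ aⁿ%ʳ≋1))
      where
      open ≋-Reasoning
      aⁿ%ʳ≋1 : a ^ (n ℕ÷.% r) ≋ 1ℤ
      aⁿ%ʳ≋1 = begin
        a ^ (n ℕ÷.% r)                               ≡⟨ ℤₚ.*-identityʳ _ ⟨
        a ^ (n ℕ÷.% r) * 1ℤ                          ≈⟨ *-cong (≋-refl {a ^ (n ℕ÷.% r)}) (^-*≋1 r (n ℕ÷./ r) aʳ≋1) ⟨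
        a ^ (n ℕ÷.% r) * a ^ (r ℕ.* (n ℕ÷./ r))       ≡⟨ ℤₚ.^-distribˡ-+-* a (n ℕ÷.% r) (r ℕ.* (n ℕ÷./ r)) ⟨
        a ^ (n ℕ÷.% r ℕ.+ r ℕ.* (n ℕ÷./ r))           ≡⟨ cong (λ k → a ^ (n ℕ÷.% r ℕ.+ k)) (ℕₚ.*-comm r (n ℕ÷./ r)) ⟩
        a ^ (n ℕ÷.% r ℕ.+ n ℕ÷./ r ℕ.* r)             ≡⟨ cong (a ^_) (ℕ÷.m≡m%n+[m/n]*n n r) ⟨
        a ^ n                                       ≈⟨ aⁿ≋1 ⟩
        1ℤ                                          ∎

  order-exists : ∀ {a} → a ≉ 0ℤ → ∃[ r ] HasOrder a r
  order-exists {a} a≉0 =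
    let i , j , i<j , _ , aⁱ≋aʲ = collision p (a ^_) p∸1<p (λ {i} _ → ^-≉0 i a≉0)
        r , (r>0 , aʳ≋1) , minimality = least Q? (ℕₚ.m<n⇒0<n∸m i<j , ^≋^⇒^∸≋1 a≉0 (ℕₚ.<⇒≤ i<j) aⁱ≋aʲ)
    in r , order-minimal r>0 aʳ≋1 minimality
    where
    Q? : ∀ k → Dec (0 ℕ.< k × a ^ k ≋ 1ℤ)
    Q? k = (0 ℕₚ.<? k) ×-dec (a ^ k ≋? 1ℤ)

  order-^ : ∀ {a} u {r} → HasOrder a (u ℕ.* r) → HasOrder (a ^ u) r
  order-^ {a} u {r} ord = record
    { order>0  = ℕₚ.n≢0⇒n>0 λ { refl → ℕₚ.<⇒≢ (order>0 ord) (sym (ℕₚ.*-zeroʳ u)) }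
    ; ^order≋1 = ≋-trans (≡⇒≋ (ℤₚ.^-*-assoc a u r)) (^order≋1 ord)
    ; order∣   = λ {n} aᵘⁿ≋1 →
        ℕ∣.*-cancelˡ-∣ u (order∣ ord (≋-trans (≡⇒≋ (sym (ℤₚ.^-*-assoc a u n))) aᵘⁿ≋1))
    }
    where instance _ = ℕ.>-nonZero (ℕₚ.n≢0⇒n>0 λ { refl → ℕₚ.<⇒≢ (order>0 ord) refl })

  *-^≋1 : ∀ {a b} n m → (a * b) ^ n ≋ 1ℤ → b ^ m ≋ 1ℤ → a ^ (n ℕ.* m) ≋ 1ℤ
  *-^≋1 {a} {b} n m abⁿ≋1 bᵐ≋1 = begin
    a ^ (n ℕ.* m)                     ≡⟨ ℤₚ.*-identityʳ (a ^ (n ℕ.* m)) ⟨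
    a ^ (n ℕ.* m) * 1ℤ                ≈⟨ *-cong (≋-refl {a ^ (n ℕ.* m)}) bⁿᵐ≋1 ⟨
    a ^ (n ℕ.* m) * b ^ (n ℕ.* m)     ≡⟨ ^-distrib-* a b (n ℕ.* m) ⟨
    (a * b) ^ (n ℕ.* m)               ≈⟨ ^-*≋1 n m abⁿ≋1 ⟩
    1ℤ                                ∎
    where
    open ≋-Reasoning
    bⁿᵐ≋1 : b ^ (n ℕ.* m) ≋ 1ℤ
    bⁿᵐ≋1 = ^-*≋1ʳ n m bᵐ≋1

  order-* : ∀ {a b u v} → HasOrder a u → HasOrder b v → Coprime u v → HasOrder (a * b) (u ℕ.* v)
  order-* {a} {b} {u} {v} ord-a ord-b u⊥v = record
    { order>0  = ℕₚ.*-mono-≤ (order>0 ord-a) (order>0 ord-b)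
    ; ^order≋1 = begin
        (a * b) ^ (u ℕ.* v)             ≡⟨ ^-distrib-* a b (u ℕ.* v) ⟩
        a ^ (u ℕ.* v) * b ^ (u ℕ.* v)   ≈⟨ *-cong (^-*≋1 u v (^order≋1 ord-a)) (^-*≋1ʳ u v (^order≋1 ord-b)) ⟩
        1ℤ                              ∎
    ; order∣   = uv∣
    }
    where
    open ≋-Reasoning
    uv∣ : ∀ {n} → (a * b) ^ n ≋ 1ℤ → u ℕ.* v ℕ∣.∣ n
    uv∣ {n} abⁿ≋1 = subst (u ℕ.* v ℕ∣.∣_) (sym n≡uq) (ℕ∣.*-monoʳ-∣ u v∣q)
      where
      baⁿ≋1 : (b * a) ^ n ≋ 1ℤ
      baⁿ≋1 = ≋-trans (≡⇒≋ (cong (_^ n) (ℤₚ.*-comm b a))) abⁿ≋1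
      u∣n : u ℕ∣.∣ n
      u∣n = coprime-divisor u⊥v
              (subst (u ℕ∣.∣_) (ℕₚ.*-comm n v) (order∣ ord-a (*-^≋1 n v abⁿ≋1 (^order≋1 ord-b))))
      v∣n : v ℕ∣.∣ n
      v∣n = coprime-divisor (Coprime-sym u⊥v)
              (subst (v ℕ∣.∣_) (ℕₚ.*-comm n u) (order∣ ord-b (*-^≋1 n u baⁿ≋1 (^order≋1 ord-a))))
      n≡uq : n ≡ u ℕ.* ℕ∣.quotient u∣n
      n≡uq = ℕ∣.m∣n⇒n≡m*quotient u∣n
      v∣q : v ℕ∣.∣ ℕ∣.quotient u∣n
      v∣q = coprime-divisor (Coprime-sym u⊥v) (subst (v ℕ∣.∣_) n≡uq v∣n)

  order-^-injective-≤ : ∀ {a r i j} → HasOrder a r → i ℕ.≤ j → j ℕ.< r → a ^ i ≋ a ^ j → i ≡ j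
  order-^-injective-≤ {i = i} {j} ord i≤j j<r aⁱ≋aʲ = ℕₚ.≤-antisym i≤j (ℕₚ.m∸n≡0⇒m≤n j∸i≡0)
    where
    j∸i≡0 : j ℕ.∸ i ≡ 0
    j∸i≡0 = ∣∧<⇒≡0 (order∣ ord (^≋^⇒^∸≋1 (order⇒≉0 ord) i≤j aⁱ≋aʲ)) (ℕₚ.≤-<-trans (ℕₚ.m∸n≤m j i) j<r)

  order-^-injective : ∀ {a r i j} → HasOrder a r → i ℕ.< r → j ℕ.< r → a ^ i ≋ a ^ j → i ≡ j
  order-^-injective {i = i} {j} ord i<r j<r aⁱ≋aʲ with ℕₚ.≤-total i j
  ... | inj₁ i≤j = order-^-injective-≤ ord i≤j j<r aⁱ≋aʲ
  ... | inj₂ j≤i = sym (order-^-injective-≤ ord j≤i i<r (≋-sym aⁱ≋aʲ))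

  order≤p∸1 : ∀ {a r} → HasOrder a r → r ℕ.≤ p ℕ.∸ 1
  order≤p∸1 {a} {r} ord = incongruent-nonzero-bound r (a ^_)
    (λ i<j j<r aⁱ≋aʲ → ℕₚ.<⇒≢ i<j (order-^-injective ord (ℕₚ.<-trans i<j j<r) j<r aⁱ≋aʲ))
    (λ {i} _ → ^-≉0 i (order⇒≉0 ord))

  LargerOrder : ℕ → Set
  LargerOrder e = ∃₂ λ c e′ → HasOrder c e′ × e ℕ.< e′

  order-increase : ∀ {a b e s} → HasOrder a e → HasOrder b s → ¬ s ℕ∣.∣ e → LargerOrder e
  order-increase {a} {b} {e} {s} ord-a ord-b s∤e
    with t , k , t-prime , tᵏ∣s , tᵏ∤e ← prime-power-separating s (order>0 ord-b) s∤e
    with j , e′ , e≡tʲe′ , t∤e′ ← prime-power-split t-prime e {{ℕ.>-nonZero (order>0 ord-a)}}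
    = a ^ (t ℕ.^ j) * b ^ q , e′ ℕ.* t ℕ.^ k , order-* ord-a′ ord-b′ e′⊥tᵏ , e<e′tᵏ
    where
    q = ℕ∣.quotient tᵏ∣s
    j<k : j ℕ.< k
    j<k = ℕₚ.≰⇒> λ k≤j →
      tᵏ∤e (subst (t ℕ.^ k ℕ∣.∣_) (sym e≡tʲe′) (ℕ∣.∣-trans (^-monoʳ-∣ t k≤j) (ℕ∣.m∣m*n e′)))
    ord-a′ : HasOrder (a ^ (t ℕ.^ j)) e′
    ord-a′ = order-^ (t ℕ.^ j) (subst (HasOrder a) e≡tʲe′ ord-a)
    ord-b′ : HasOrder (b ^ q) (t ℕ.^ k)
    ord-b′ = order-^ q (subst (HasOrder b) (ℕ∣.m∣n⇒n≡quotient*m tᵏ∣s) ord-b)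
    e′⊥tᵏ : Coprime e′ (t ℕ.^ k)
    e′⊥tᵏ = coprime-^ʳ (Coprime-sym (prime∤⇒coprime t-prime t∤e′)) k
    e<e′tᵏ : e ℕ.< e′ ℕ.* t ℕ.^ k
    e<e′tᵏ = begin-strict
      e                 ≡⟨ e≡tʲe′ ⟩
      t ℕ.^ j ℕ.* e′    ≡⟨ ℕₚ.*-comm (t ℕ.^ j) e′ ⟩
      e′ ℕ.* t ℕ.^ j    <⟨ ℕₚ.*-monoʳ-< e′ {{ℕ.>-nonZero (order>0 ord-a′)}} (ℕₚ.^-monoʳ-< t (prime≥2 t-prime) j<k) ⟩
      e′ ℕ.* t ℕ.^ k    ∎
      where open ℕₚ.≤-Reasoning

  suc<p : ∀ {x} → x ℕ.< p ℕ.∸ 1 → suc x ℕ.< p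
  suc<p {x} x<p-1 = subst (suc (suc x) ℕ.≤_) (ℕₚ.suc-pred p) (s≤s x<p-1)

  non-root⇒larger-order : ∀ {a e x} → HasOrder a e → x ℕ.< p ℕ.∸ 1 → (+ suc x) ^ e ≉ 1ℤ → LargerOrder e
  non-root⇒larger-order {e = e} {x} ord x<p-1 xᵉ≉1 =
    let s , ord-x = order-exists x≉0 in order-increase ord ord-x (λ s∣e → xᵉ≉1 (xᵉ≋1 ord-x s∣e))
    where
    x≉0 : + suc x ≉ 0ℤ
    x≉0 x≋0 with () ← ≋⇒≡ (suc<p x<p-1) p>0 x≋0
    xᵉ≋1 : ∀ {s} → HasOrder (+ suc x) s → s ℕ∣.∣ e → (+ suc x) ^ e ≋ 1ℤ
    xᵉ≋1 {s} ord-x s∣e = subst (λ k → (+ suc x) ^ k ≋ 1ℤ) (sym (ℕ∣.m∣n⇒n≡quotient*m s∣e))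
                               (^-*≋1ʳ (ℕ∣.quotient s∣e) s (^order≋1 ord-x))

  all-roots⇒p∸1≤e : ∀ {e} → 0 ℕ.< e → (∀ {x} → x ℕ.< p ℕ.∸ 1 → (+ suc x) ^ e ≋ 1ℤ) → p ℕ.∸ 1 ℕ.≤ e
  all-roots⇒p∸1≤e {e} e>0 roots = subst₂ ℕ._≤_ (length-applyUpTo (λ x → + suc x) (p ℕ.∸ 1)) (ℕₚ.suc-pred e)
    (power-root-bound (ℕ.pred e) distinct (Allₚ.applyUpTo⁺₁ (λ x → + suc x) (p ℕ.∸ 1) root))
    where
    instance _ = ℕ.>-nonZero e>0
    distinct : AllPairs _≉_ (applyUpTo (λ x → + suc x) (p ℕ.∸ 1))
    distinct = AllPairsₚ.applyUpTo⁺₁ (λ x → + suc x) (p ℕ.∸ 1) λ i<j j<p-1 xᵢ≋xⱼ →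
      ℕₚ.<⇒≢ i<j (ℕₚ.suc-injective (≋⇒≡ (suc<p (ℕₚ.<-trans i<j j<p-1)) (suc<p j<p-1) xᵢ≋xⱼ))
    root : ∀ {x} → x ℕ.< p ℕ.∸ 1 → (+ suc x) ^ suc (ℕ.pred e) ≋ 1ℤ
    root {x} x<p-1 = subst (λ k → (+ suc x) ^ k ≋ 1ℤ) (sym (ℕₚ.suc-pred e)) (roots x<p-1)

  larger-order-or-primitive : ∀ {a e} → HasOrder a e → LargerOrder e ⊎ HasOrder a (p ℕ.∸ 1)
  larger-order-or-primitive {a} {e} ord = from-search (ℕₚ.anyUpTo? (λ x → ¬? ((+ suc x) ^ e ≋? 1ℤ)) (p ℕ.∸ 1))
    where
    from-search : Dec (∃[ x ] (x ℕ.< p ℕ.∸ 1 × (+ suc x) ^ e ≉ 1ℤ)) → LargerOrder e ⊎ HasOrder a (p ℕ.∸ 1)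
    from-search (yes (x , x<p-1 , xᵉ≉1)) = inj₁ (non-root⇒larger-order ord x<p-1 xᵉ≉1)
    from-search (no ∄x) =
      inj₂ (subst (HasOrder a) (ℕₚ.≤-antisym (order≤p∸1 ord) (all-roots⇒p∸1≤e (order>0 ord) roots)) ord)
      where
      roots : ∀ {x} → x ℕ.< p ℕ.∸ 1 → (+ suc x) ^ e ≋ 1ℤ
      roots {x} x<p-1 = decidable-stable ((+ suc x) ^ e ≋? 1ℤ) λ xᵉ≉1 → ∄x (x , x<p-1 , xᵉ≉1)

  primitive-root : ∃[ g ] HasOrder g (p ℕ.∸ 1)
  primitive-root = <-rec Goal step (p ℕ.∸ 1) order-1 refl
    where
    Goal : ℕ → Set
    Goal d = ∀ {a e} → HasOrder a e → p ℕ.∸ e ≡ d → ∃[ g ] HasOrder g (p ℕ.∸ 1)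
    step : ∀ d → (∀ {d′} → d′ ℕ.< d → Goal d′) → Goal d
    step _ rec ord refl with larger-order-or-primitive ord
    ... | inj₁ (c , e′ , ord-c , e<e′) =
      rec (ℕₚ.∸-monoʳ-< e<e′ (ℕₚ.≤-trans (order≤p∸1 ord-c) (ℕₚ.m∸n≤m p 1))) ord-c refl
    ... | inj₂ ord-p-1                 = _ , ord-p-1
    order-1 : HasOrder 1ℤ 1
    order-1 = record { order>0 = ℕ.z<s ; ^order≋1 = ≋-refl ; order∣ = λ {n} _ → ℕ∣.1∣ n }

module OddModulus (m : ℕ) (prime : Prime (ℕ.suc (m ℕ.+ m))) where

  open import Data.Nat.Base as ℕ using (zero; suc; z≤n; s≤s)
  import Data.Nat.Properties as ℕₚ
  open import Data.Integer.Base using (+_; _-_)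
  open import Data.Product using (_,_)
  open import Relation.Nullary using (yes; no)
  open import Relation.Binary.PropositionalEquality
  open Arithmetic using (if-≡ᵇ-yes; if-≡ᵇ-no)

  p : ℕ
  p = suc (m ℕ.+ m)

  open Modular p prime public

  p∸m≡suc-m : p ℕ.∸ m ≡ suc m
  p∸m≡suc-m = ℕₚ.m+n∸n≡m (suc m) m

  m≥1 : 1 ℕ.≤ m
  m≥1 = half-positive m p>1
    where
    half-positive : ∀ k → 1 ℕ.< suc (k ℕ.+ k) → 1 ℕ.≤ k
    half-positive zero    (s≤s ())
    half-positive (suc k) _ = s≤s z≤n

  ‖‖≡residue : ∀ {a} → residue a ℕ.≤ m → ‖ a ‖ ≡ residue a
  ‖‖≡residue {a} r≤m = trans (‖‖≡ a) (ℕₚ.m≤n⇒m⊓n≡m (begin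
    residue a             ≤⟨ ℕₚ.m≤n⇒m≤1+n r≤m ⟩
    suc m                 ≡⟨ p∸m≡suc-m ⟨
    p ℕ.∸ m               ≤⟨ ℕₚ.∸-monoʳ-≤ p r≤m ⟩
    p ℕ.∸ residue a       ∎))
    where open ℕₚ.≤-Reasoning

  p∸residue≤m : ∀ {a} → m ℕ.< residue a → p ℕ.∸ residue a ℕ.≤ m
  p∸residue≤m m<r = ℕₚ.≤-trans (ℕₚ.∸-monoʳ-≤ p m<r) (ℕₚ.≤-reflexive (ℕₚ.m+n∸n≡m m m))

  ‖‖<residue : ∀ {a} → m ℕ.< residue a → ‖ a ‖ ℕ.< residue a
  ‖‖<residue {a} m<r = ℕₚ.≤-<-trans (ℕₚ.≤-trans (‖‖≤p∸residue a) (p∸residue≤m m<r)) m<r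

  ‖‖≤m : ∀ a → ‖ a ‖ ℕ.≤ m
  ‖‖≤m a with residue a ℕₚ.≤? m
  ... | yes r≤m = ℕₚ.≤-trans (ℕₚ.≤-reflexive (‖‖≡residue r≤m)) r≤m
  ... | no r≰m  = ℕₚ.≤-trans (‖‖≤p∸residue a) (p∸residue≤m (ℕₚ.≰⇒> r≰m))

  ‖+‖ : ∀ {x} → x ℕ.≤ m → ‖ + x ‖ ≡ x
  ‖+‖ {x} x≤m = trans (‖‖≡residue (ℕₚ.≤-trans (ℕₚ.≤-reflexive r≡x) x≤m)) r≡x
    where
    r≡x : residue (+ x) ≡ x
    r≡x = residue-pos (s≤s (ℕₚ.≤-trans x≤m (ℕₚ.m≤m+n m m)))

  start-≤ : ∀ {u v} → u ℕ.< p → v ℕ.< p → residue (+ v - + u) ℕ.≤ m → start p (u , v) ≡ u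
  start-≤ {u} {v} u<p v<p r≤m =
    if-≡ᵇ-yes _ _ (trans (diffMod≡residue u<p v<p) (sym (trans (cd≡‖diff‖ u<p v<p) (‖‖≡residue r≤m))))

  start-> : ∀ {u v} → u ℕ.< p → v ℕ.< p → m ℕ.< residue (+ v - + u) → start p (u , v) ≡ v
  start-> {u} {v} u<p v<p m<r = if-≡ᵇ-no _ _ λ diffMod≡cd →
    ℕₚ.<⇒≢ (‖‖<residue m<r) (sym (trans (sym (diffMod≡residue u<p v<p)) (trans diffMod≡cd (cd≡‖diff‖ u<p v<p))))

module GeneratorPath (m : ℕ) (prime : Prime (ℕ.suc (m ℕ.+ m))) where

  open import Data.Nat.Base as ℕ using (suc; z≤n; s≤s)
  import Data.Nat.Properties as ℕₚ
  open import Data.Integer.Base using (ℤ; +_; 0ℤ; 1ℤ; -1ℤ; _+_; _*_; _-_; -_; _^_)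
  import Data.Integer.Properties as ℤₚ
  open import Data.Integer.Tactic.RingSolver using (solve-∀)
  open import Data.Sum.Base using (_⊎_; inj₁; inj₂; [_,_]′)
  open import Data.Product using (∃₂; ∃-syntax; _×_; _,_; proj₁; proj₂)
  open import Data.Empty using (⊥-elim)
  open import Relation.Nullary using (¬_; Dec; yes; no; _×-dec_)
  open import Relation.Binary.PropositionalEquality
  open import Function using (_∘_; id)
  open import Data.Bool.Base using (if_then_else_)
  open Arithmetic using (if-≡ᵇ-yes; if-≡ᵇ-no)
  open import Data.Fin.Base using (Fin; toℕ; fromℕ<)
  import Data.Fin.Properties as Finₚ
  open import Data.List.Base using (List; applyUpTo)
  import Data.List.Relation.Unary.Unique.Propositional.Properties as Uniqueₚ
  open Paths
  open OddModulus m prime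
  open PrimitiveRoot p prime

  g : ℤ
  g = proj₁ primitive-root

  g-order : HasOrder g (m ℕ.+ m)
  g-order = proj₂ primitive-root

  G : ℕ → ℤ
  G k = g ^ k

  G-injective : ∀ {i j} → i ℕ.< m ℕ.+ m → j ℕ.< m ℕ.+ m → G i ≋ G j → i ≡ j
  G-injective = order-^-injective g-order

  G≉0 : ∀ k → G k ≉ 0ℤ
  G≉0 k = ^-≉0 k (order⇒≉0 g-order)

  m<m+m : m ℕ.< m ℕ.+ m
  m<m+m = ℕₚ.m<m+n m m≥1

  0<m+m : 0 ℕ.< m ℕ.+ m
  0<m+m = ℕₚ.<-≤-trans m≥1 (ℕₚ.m≤m+n m m)

  G[m]≋-1 : G m ≋ -1ℤ
  G[m]≋-1 = [ ⊥-elim ∘ G[m]≉1 , id ]′ (*-self≋1⇒≋±1 G[m]²≋1)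
    where
    G[m]²≋1 : G m * G m ≋ 1ℤ
    G[m]²≋1 = ≋-trans (≡⇒≋ (sym (ℤₚ.^-distribˡ-+-* g m m))) (^order≋1 g-order)
    G[m]≉1 : G m ≉ 1ℤ
    G[m]≉1 Gm≋1 = ℕₚ.<⇒≢ m≥1 (sym (G-injective m<m+m 0<m+m Gm≋1))

  G-+m : ∀ k → G (k ℕ.+ m) ≋ - G k
  G-+m k = begin
    G (k ℕ.+ m)    ≡⟨ ℤₚ.^-distribˡ-+-* g k m ⟩
    G k * G m      ≈⟨ *-cong (≋-refl {G k}) G[m]≋-1 ⟩
    G k * -1ℤ      ≡⟨ identity (G k) ⟩
    - G k          ∎
    where
    open ≋-Reasoning
    identity : ∀ x → x * -1ℤ ≡ - x
    identity = solve-∀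

  G-≋±-injective : ∀ {i j} → i ℕ.< m ℕ.+ m → j ℕ.< m ℕ.+ m → G i ≋± G j →
                   i ≡ j ⊎ i ≡ j ℕ.+ m ⊎ j ≡ i ℕ.+ m
  G-≋±-injective i<2m j<2m (inj₁ Gi≋Gj) = inj₁ (G-injective i<2m j<2m Gi≋Gj)
  G-≋±-injective {i} {j} i<2m j<2m (inj₂ Gi≋-Gj) with j ℕₚ.<? m
  ... | yes j<m = inj₂ (inj₁ (G-injective i<2m (ℕₚ.+-monoˡ-< m j<m) (≋-trans Gi≋-Gj (≋-sym (G-+m j)))))
  ... | no j≮m  = inj₂ (inj₂ (trans (sym j∸m+m≡j) (cong (ℕ._+ m) (sym i≡j∸m))))
    where
    j∸m+m≡j : j ℕ.∸ m ℕ.+ m ≡ j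
    j∸m+m≡j = ℕₚ.m∸n+n≡m (ℕₚ.≮⇒≥ j≮m)
    -Gj≋Gj∸m : - G j ≋ G (j ℕ.∸ m)
    -Gj≋Gj∸m = ≋-trans (-‿cong (≋-trans (≡⇒≋ (cong G (sym j∸m+m≡j))) (G-+m (j ℕ.∸ m))))
                       (≡⇒≋ (ℤₚ.neg-involutive _))
    i≡j∸m : i ≡ j ℕ.∸ m
    i≡j∸m = G-injective i<2m (ℕₚ.≤-<-trans (ℕₚ.m∸n≤m j m) j<2m) (≋-trans Gi≋-Gj -Gj≋Gj∸m)

  powers-cover : ∀ {c y} → c ≉ 0ℤ → y ≉ 0ℤ → ∃[ k ] (k ℕ.< m ℕ.+ m × G k * c ≋ y)
  powers-cover {c} {y} c≉0 y≉0 = from (collision p f p∸1<p f≉0)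
    where
    -- The p nonzero values G 0 * c, …, G (m + m - 1) * c, y collide somewhere.

    f : ℕ → ℤ
    f k = if k ℕ.≡ᵇ m ℕ.+ m then y else G k * c
    f-top : f (m ℕ.+ m) ≡ y
    f-top = if-≡ᵇ-yes (m ℕ.+ m) (m ℕ.+ m) refl
    f-below : ∀ {k} → k ≢ m ℕ.+ m → f k ≡ G k * c
    f-below = if-≡ᵇ-no _ (m ℕ.+ m)
    f≉0 : ∀ {k} → k ℕ.< p → f k ≉ 0ℤ
    f≉0 {k} _ with k ℕₚ.≟ m ℕ.+ m
    ... | yes refl = subst (_≉ 0ℤ) (sym f-top) y≉0
    ... | no k≢2m  = subst (_≉ 0ℤ) (sym (f-below k≢2m)) (*-≉0 (G≉0 k) c≉0)
    from : (∃₂ λ i j → i ℕ.< j × j ℕ.< p × f i ≋ f j) → ∃[ k ] (k ℕ.< m ℕ.+ m × G k * c ≋ y)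
    from (i , j , i<j , j<p , fᵢ≋fⱼ) with j ℕₚ.≟ m ℕ.+ m
    ... | yes refl = i , i<j , subst₂ _≋_ (f-below (ℕₚ.<⇒≢ i<j)) f-top fᵢ≋fⱼ
    ... | no j≢2m  = ⊥-elim (ℕₚ.<⇒≢ i<j (G-injective i<2m j<2m (*-cancelʳ c≉0 Gᵢc≋Gⱼc)))
      where
      j<2m : j ℕ.< m ℕ.+ m
      j<2m = ℕₚ.≤∧≢⇒< (ℕₚ.≤-pred j<p) j≢2m
      i<2m : i ℕ.< m ℕ.+ m
      i<2m = ℕₚ.<-trans i<j j<2m
      Gᵢc≋Gⱼc : G i * c ≋ G j * c
      Gᵢc≋Gⱼc = subst₂ _≋_ (f-below (ℕₚ.<⇒≢ i<2m)) (f-below j≢2m) fᵢ≋fⱼ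

  g-1≉0 : g - 1ℤ ≉ 0ℤ
  g-1≉0 g-1≋0 = ℕₚ.1+n≢0 (G-injective 1<m+m 0<m+m G1≋G0)
    where
    1<m+m : 1 ℕ.< m ℕ.+ m
    1<m+m = ℕₚ.+-mono-≤ m≥1 m≥1
    G1≋G0 : G 1 ≋ G 0
    G1≋G0 = *-cong {g} {1ℤ} (-≋0⇒≋ g-1≋0) (≋-refl {1ℤ})

  g+1≉0 : 2 ℕ.≤ m → g + 1ℤ ≉ 0ℤ
  g+1≉0 m≥2 g+1≋0 = ℕₚ.1+n≢0 (G-injective 2<m+m 0<m+m G2≋G0)
    where
    2<m+m : 2 ℕ.< m ℕ.+ m
    2<m+m = ℕₚ.<-≤-trans (s≤s (s≤s (s≤s z≤n))) (ℕₚ.+-mono-≤ m≥2 m≥2)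
    G2≋G0 : G 2 ≋ G 0
    G2≋G0 = *-cong {g} { -1ℤ } (+≋0⇒≋- g+1≋0) (*-cong {g} { -1ℤ } (+≋0⇒≋- g+1≋0) (≋-refl {1ℤ}))

  vertex : ℕ → Fin p
  vertex k = fromℕ< (residue<p (G k))

  vertex≋G : ∀ k → + toℕ (vertex k) ≋ G k
  vertex≋G k = ≋-trans (≡⇒≋ (cong +_ (Finₚ.toℕ-fromℕ< (residue<p (G k))))) (residue≋ (G k))

  edge : ℕ → Edge
  edge k = toℕ (vertex k) , toℕ (vertex (suc k))

  D : ℕ → ℤ
  D k = G k * (g - 1ℤ)

  τ : ℕ → ℕ
  τ k = ‖ D k ‖

  edge-diff≋D : ∀ k → + toℕ (vertex (suc k)) - + toℕ (vertex k) ≋ D k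
  edge-diff≋D k = ≋-trans (+-cong (vertex≋G (suc k)) (-‿cong (vertex≋G k))) (≡⇒≋ (identity g (G k)))
    where identity : ∀ g x → g * x - x ≡ x * (g - 1ℤ)
          identity = solve-∀

  etype-edge : ∀ k → etype p (edge k) ≡ τ k
  etype-edge k = trans (cd≡‖diff‖ (Finₚ.toℕ<n (vertex k)) (Finₚ.toℕ<n (vertex (suc k)))) (‖‖-cong (edge-diff≋D k))

  D≉0 : ∀ k → D k ≉ 0ℤ
  D≉0 k = *-≉0 (G≉0 k) g-1≉0

  D-+m : ∀ k → D (k ℕ.+ m) ≋ - D k
  D-+m k = ≋-trans (*-cong (G-+m k) (≋-refl {g - 1ℤ})) (≡⇒≋ (sym (ℤₚ.neg-distribˡ-* (G k) (g - 1ℤ))))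

  τ-+m : ∀ k → τ (k ℕ.+ m) ≡ τ k
  τ-+m k = ‖‖-cong± (inj₂ (D-+m k))

  τ≡τ⇒G≋±G : ∀ {i j} → τ i ≡ τ j → G i ≋± G j
  τ≡τ⇒G≋±G τi≡τj = ≋±-*-cancelʳ g-1≉0 (‖‖-injective τi≡τj)

  τ-injective : ∀ {i j} → i ℕ.< m → j ℕ.< m → τ i ≡ τ j → i ≡ j
  τ-injective {i} {j} i<m j<m τi≡τj = from-G (G-≋±-injective (<2m i<m) (<2m j<m) (τ≡τ⇒G≋±G {i} {j} τi≡τj))
    where
    <2m : ∀ {k} → k ℕ.< m → k ℕ.< m ℕ.+ m
    <2m k<m = ℕₚ.<-≤-trans k<m (ℕₚ.m≤m+n m m)
    ≱+m : ∀ {k l} → k ℕ.< m → k ≢ l ℕ.+ m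
    ≱+m {l = l} k<m k≡l+m = ℕₚ.<⇒≱ k<m (subst (m ℕ.≤_) (sym k≡l+m) (ℕₚ.m≤n+m m l))
    from-G : i ≡ j ⊎ i ≡ j ℕ.+ m ⊎ j ≡ i ℕ.+ m → i ≡ j
    from-G (inj₁ i≡j)          = i≡j
    from-G (inj₂ (inj₁ i≡j+m)) = ⊥-elim (≱+m i<m i≡j+m)
    from-G (inj₂ (inj₂ j≡i+m)) = ⊥-elim (≱+m j<m j≡i+m)

  τ-mod-m : ∀ {k} → k ℕ.< m ℕ.+ m → ∃[ k′ ] (k′ ℕ.< m × τ k′ ≡ τ k)
  τ-mod-m {k} k<2m with k ℕₚ.<? m
  ... | yes k<m = k , k<m , refl
  ... | no k≮m  = k ℕ.∸ m , k∸m<m , trans (sym (τ-+m (k ℕ.∸ m))) (cong τ k∸m+m≡k)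
    where
    k∸m+m≡k : k ℕ.∸ m ℕ.+ m ≡ k
    k∸m+m≡k = ℕₚ.m∸n+n≡m (ℕₚ.≮⇒≥ k≮m)
    k∸m<m : k ℕ.∸ m ℕ.< m
    k∸m<m = ℕₚ.+-cancelʳ-< m (k ℕ.∸ m) m (subst (ℕ._< m ℕ.+ m) (sym k∸m+m≡k) k<2m)

  τ-onto : ∀ {x} → 0 ℕ.< x → x ℕ.≤ m → ∃[ k ] (k ℕ.< m × τ k ≡ x)
  τ-onto {x} x>0 x≤m =
    let k , k<2m , Dk≋x = powers-cover g-1≉0 x≉0
        k′ , k′<m , τk′≡τk = τ-mod-m k<2m
    in k′ , k′<m , trans τk′≡τk (trans (‖‖-cong Dk≋x) (‖+‖ x≤m))
    where
    x≉0 : + x ≉ 0ℤ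
    x≉0 x≋0 = ℕₚ.<⇒≢ x>0 (sym (≋⇒≡ (s≤s (ℕₚ.≤-trans x≤m (ℕₚ.m≤m+n m m))) ℕ.z<s x≋0))

  start-edge-≤ : ∀ {k} → residue (D k) ℕ.≤ m → start p (edge k) ≡ toℕ (vertex k)
  start-edge-≤ {k} r≤m =
    start-≤ (Finₚ.toℕ<n (vertex k)) (Finₚ.toℕ<n (vertex (suc k)))
            (subst (ℕ._≤ m) (sym (residue-cong (edge-diff≋D k))) r≤m)

  start-edge-> : ∀ {k} → m ℕ.< residue (D k) → start p (edge k) ≡ toℕ (vertex (suc k))
  start-edge-> {k} m<r =
    start-> (Finₚ.toℕ<n (vertex k)) (Finₚ.toℕ<n (vertex (suc k)))
            (subst (m ℕ.<_) (sym (residue-cong (edge-diff≋D k))) m<r)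

  residue-D-+m : ∀ k → residue (D (k ℕ.+ m)) ≡ p ℕ.∸ residue (D k)
  residue-D-+m k = trans (residue-cong (D-+m k)) (residue-neg (D≉0 k))

  cd-vertex : ∀ i j → cd p (toℕ (vertex i)) (toℕ (vertex j)) ≡ ‖ G i - G j ‖
  cd-vertex i j = trans (cd≡‖-‖ (Finₚ.toℕ<n (vertex i)) (Finₚ.toℕ<n (vertex j)))
                        (‖‖-cong (+-cong (vertex≋G i) (-‿cong (vertex≋G j))))

  -- As D (q + m) ≡ - D q, exactly one of the edges q and q + m starts at its first vertex.
  pair-cd : ∀ q → cdE p (edge q) (edge (q ℕ.+ m)) ≡ ‖ G q * (g + 1ℤ) ‖
  pair-cd q = by-cases (residue (D q) ℕₚ.≤? m)
    where
    open ≡-Reasoning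
    by-cases : Dec (residue (D q) ℕ.≤ m) → cdE p (edge q) (edge (q ℕ.+ m)) ≡ ‖ G q * (g + 1ℤ) ‖
    by-cases (yes r≤m) = begin
      cd p (start p (edge q)) (start p (edge (q ℕ.+ m)))    ≡⟨ cong₂ (cd p) (start-edge-≤ {q} r≤m) (start-edge-> {q ℕ.+ m} m<r′) ⟩
      cd p (toℕ (vertex q)) (toℕ (vertex (suc q ℕ.+ m)))    ≡⟨ cd-vertex q (suc q ℕ.+ m) ⟩
      ‖ G q - G (suc q ℕ.+ m) ‖                             ≡⟨ ‖‖-cong (+-cong (≋-refl {G q}) (-‿cong (G-+m (suc q)))) ⟩
      ‖ G q - - (g * G q) ‖                                 ≡⟨ cong ‖_‖ (identity g (G q)) ⟩
      ‖ G q * (g + 1ℤ) ‖                                    ∎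
      where
      identity : ∀ g x → x - - (g * x) ≡ x * (g + 1ℤ)
      identity = solve-∀
      m<r′ : m ℕ.< residue (D (q ℕ.+ m))
      m<r′ = subst (m ℕ.<_) (sym (residue-D-+m q))
                   (ℕₚ.≤-trans (ℕₚ.≤-reflexive (sym p∸m≡suc-m)) (ℕₚ.∸-monoʳ-≤ p r≤m))
    by-cases (no r≰m) = begin
      cd p (start p (edge q)) (start p (edge (q ℕ.+ m)))    ≡⟨ cong₂ (cd p) (start-edge-> {q} m<r) (start-edge-≤ {q ℕ.+ m} r′≤m) ⟩
      cd p (toℕ (vertex (suc q))) (toℕ (vertex (q ℕ.+ m)))  ≡⟨ cd-vertex (suc q) (q ℕ.+ m) ⟩
      ‖ G (suc q) - G (q ℕ.+ m) ‖                           ≡⟨ ‖‖-cong (+-cong (≋-refl {G (suc q)}) (-‿cong (G-+m q))) ⟩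
      ‖ g * G q - - G q ‖                                   ≡⟨ cong ‖_‖ (identity g (G q)) ⟩
      ‖ G q * (g + 1ℤ) ‖                                    ∎
      where
      identity : ∀ g x → g * x - - x ≡ x * (g + 1ℤ)
      identity = solve-∀
      m<r : m ℕ.< residue (D q)
      m<r = ℕₚ.≰⇒> r≰m
      r′≤m : residue (D (q ℕ.+ m)) ℕ.≤ m
      r′≤m = subst (ℕ._≤ m) (sym (residue-D-+m q)) (p∸residue≤m m<r)

  pair-cd-injective : ∀ {q₁ q₂} → 2 ℕ.≤ m → ‖ G q₁ * (g + 1ℤ) ‖ ≡ ‖ G q₂ * (g + 1ℤ) ‖ → τ q₁ ≡ τ q₂
  pair-cd-injective {q₁} {q₂} m≥2 eq = ‖‖-cong± {D q₁} {D q₂} (≋±-*-congʳ (g - 1ℤ) Gq₁≋±Gq₂)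
    where
    Gq₁≋±Gq₂ : G q₁ ≋± G q₂
    Gq₁≋±Gq₂ = ≋±-*-cancelʳ (g+1≉0 m≥2) (‖‖-injective eq)

  #edges : ℕ
  #edges = m ℕ.+ ℕ.pred m

  suc-#edges : suc #edges ≡ m ℕ.+ m
  suc-#edges = trans (sym (ℕₚ.+-suc m (ℕ.pred m))) (cong (m ℕ.+_) (ℕₚ.suc-pred m {{ℕ.>-nonZero m≥1}}))

  path : List (Fin p)
  path = applyUpTo vertex (suc #edges)

  pathEdges-path : pathEdges path ≡ applyUpTo edge #edges
  pathEdges-path = pathEdges-applyUpTo vertex #edges

  path-unique : IsPath path
  path-unique = Uniqueₚ.applyUpTo⁺₁ vertex (suc #edges) λ {i} {j} i<j j<n vᵢ≡vⱼ →
    ℕₚ.<⇒≢ i<j (G-injective (<2m (ℕₚ.<-trans i<j j<n)) (<2m j<n)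
      (≋-trans (≋-sym (vertex≋G i)) (≋-trans (≡⇒≋ (cong (λ v → + toℕ v) vᵢ≡vⱼ)) (vertex≋G j))))
    where <2m : ∀ {k} → k ℕ.< suc #edges → k ℕ.< m ℕ.+ m
          <2m {k} = subst (k ℕ.<_) suc-#edges

  countType-path : ∀ x → countType p x (pathEdges path) ≡ count τ x #edges
  countType-path x = trans (cong (countType p x) pathEdges-path)
                           (trans (countType-applyUpTo p x edge #edges) (count-cong x #edges λ {k} _ → etype-edge k))

  count-τ-split : ∀ x → count τ x #edges ≡ count τ x m ℕ.+ count τ x (ℕ.pred m)
  count-τ-split x = trans (count-+ τ x m (ℕ.pred m))
                          (cong (count τ x m ℕ.+_) (count-cong x (ℕ.pred m) λ {k} _ → trans (cong τ (ℕₚ.+-comm m k)) (τ-+m k)))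

  count-τ-hit : ∀ {x k₀ L} → L ℕ.≤ m → k₀ ℕ.< L → τ k₀ ≡ x → count τ x L ≡ 1
  count-τ-hit {x} {k₀} {L} L≤m k₀<L τk₀≡x = count≡1 τ x L k₀<L τk₀≡x λ k<L τk≡x →
    τ-injective (ℕₚ.<-≤-trans k<L L≤m) (ℕₚ.<-≤-trans k₀<L L≤m) (trans τk≡x (sym τk₀≡x))

  count-τ-miss : ∀ {x k₀ L} → L ℕ.≤ k₀ → k₀ ℕ.< m → τ k₀ ≡ x → count τ x L ≡ 0
  count-τ-miss {x} {k₀} {L} L≤k₀ k₀<m τk₀≡x = count≡0 τ x L λ k<L τk≡x →
    ℕₚ.<⇒≢ (ℕₚ.<-≤-trans k<L L≤k₀)
           (τ-injective (ℕₚ.<-≤-trans (ℕₚ.<-≤-trans k<L L≤k₀) (ℕₚ.<⇒≤ k₀<m)) k₀<m (trans τk≡x (sym τk₀≡x)))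

  TwiceOrLastOnce : ℕ → Set
  TwiceOrLastOnce x = count τ x #edges ≡ 2 ⊎ (count τ x #edges ≡ 1 × x ≡ τ (ℕ.pred m))

  count-in-range : ∀ {x} → 0 ℕ.< x → x ℕ.≤ m → TwiceOrLastOnce x
  count-in-range {x} x>0 x≤m =
    let k₀ , k₀<m , τk₀≡x = τ-onto x>0 x≤m in by-cases k₀<m τk₀≡x (k₀ ℕₚ.<? ℕ.pred m)
    where
    once : ∀ {k₀} → k₀ ℕ.< m → τ k₀ ≡ x → count τ x m ≡ 1
    once k₀<m τk₀≡x = count-τ-hit ℕₚ.≤-refl k₀<m τk₀≡x
    by-cases : ∀ {k₀} → k₀ ℕ.< m → τ k₀ ≡ x → Dec (k₀ ℕ.< ℕ.pred m) → TwiceOrLastOnce x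
    by-cases k₀<m τk₀≡x (yes k₀<m-1) = inj₁ (trans (count-τ-split x)
      (cong₂ ℕ._+_ (once k₀<m τk₀≡x) (count-τ-hit (ℕₚ.pred[n]≤n {m}) k₀<m-1 τk₀≡x)))
    by-cases {k₀} k₀<m τk₀≡x (no k₀≮m-1) = inj₂ (trans (count-τ-split x)
      (cong₂ ℕ._+_ (once k₀<m τk₀≡x) (count-τ-miss (ℕₚ.≮⇒≥ k₀≮m-1) k₀<m τk₀≡x)) , trans (sym τk₀≡x) (cong τ k₀≡m-1))
      where
      k₀≡m-1 : k₀ ≡ ℕ.pred m
      k₀≡m-1 = ℕₚ.≤-antisym (ℕₚ.suc[m]≤n⇒m≤pred[n] k₀<m) (ℕₚ.≮⇒≥ k₀≮m-1)

  count-out-of-range : ∀ {x} → ¬ (0 ℕ.< x × x ℕ.≤ m) → count τ x #edges ≡ 0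
  count-out-of-range {x} x∉ = count≡0 τ x #edges λ {k} _ τk≡x →
    x∉ (subst (λ y → 0 ℕ.< y × y ℕ.≤ m) τk≡x (‖‖>0 (D≉0 k) , ‖‖≤m (D k)))

  in-range? : ∀ x → Dec (0 ℕ.< x × x ℕ.≤ m)
  in-range? x = (0 ℕₚ.<? x) ×-dec (x ℕₚ.≤? m)

  count≡1⇒last-type : ∀ {x} → count τ x #edges ≡ 1 → x ≡ τ (ℕ.pred m)
  count≡1⇒last-type {x} count≡1 = by-range (in-range? x)
    where
    by-shape : TwiceOrLastOnce x → x ≡ τ (ℕ.pred m)
    by-shape (inj₁ count≡2)         = ⊥-elim (ℕₚ.1+n≢0 (ℕₚ.suc-injective (trans (sym count≡2) count≡1)))
    by-shape (inj₂ (_ , x≡τ[m-1])) = x≡τ[m-1]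
    by-range : Dec (0 ℕ.< x × x ℕ.≤ m) → x ≡ τ (ℕ.pred m)
    by-range (no x∉)            = ⊥-elim (ℕₚ.1+n≢0 (trans (sym count≡1) (count-out-of-range x∉)))
    by-range (yes (x>0 , x≤m)) = by-shape (count-in-range x>0 x≤m)

  count≤2 : ∀ x → count τ x #edges ℕ.≤ 2
  count≤2 x = by-range (in-range? x)
    where
    by-shape : TwiceOrLastOnce x → count τ x #edges ℕ.≤ 2
    by-shape (inj₁ count≡2)       = ℕₚ.≤-reflexive count≡2
    by-shape (inj₂ (count≡1 , _)) = ℕₚ.≤-trans (ℕₚ.≤-reflexive count≡1) (s≤s z≤n)
    by-range : Dec (0 ℕ.< x × x ℕ.≤ m) → count τ x #edges ℕ.≤ 2
    by-range (no x∉)            = ℕₚ.≤-trans (ℕₚ.≤-reflexive (count-out-of-range x∉)) z≤n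
    by-range (yes (x>0 , x≤m)) = by-shape (count-in-range x>0 x≤m)

  count≥1 : ∀ {x} → 0 ℕ.< x → x ℕ.≤ m → 1 ℕ.≤ count τ x #edges
  count≥1 x>0 x≤m = by-shape (count-in-range x>0 x≤m)
    where
    by-shape : TwiceOrLastOnce _ → 1 ℕ.≤ count τ _ #edges
    by-shape (inj₁ count≡2)       = ℕₚ.≤-trans (s≤s z≤n) (ℕₚ.≤-reflexive (sym count≡2))
    by-shape (inj₂ (count≡1 , _)) = ℕₚ.≤-reflexive (sym count≡1)

  path-GP1 : GP1 p path
  path-GP1 x x≥1 x≤m =
    subst (1 ℕ.≤_) (sym (countType-path x)) (count≥1 x≥1 (subst (x ℕ.≤_) (sym (ℕₚ.n≡⌈n+n/2⌉ m)) x≤m))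

  path-GP2 : GP2 p path
  path-GP2 = (λ x y x-once y-once → trans (count≡1⇒last-type (trans (sym (countType-path x)) x-once))
                                          (sym (count≡1⇒last-type (trans (sym (countType-path y)) y-once))))
           , (λ x → subst (ℕ._≤ 2) (sym (countType-path x)) (count≤2 x))

  pair-of-same-type : ∀ {i j} → i ≢ j → i ℕ.< #edges → j ℕ.< #edges → i ≡ j ⊎ i ≡ j ℕ.+ m ⊎ j ≡ i ℕ.+ m →
                      ∃[ q ] (q ℕ.+ m ℕ.< #edges × τ q ≡ τ i × cdE p (edge i) (edge j) ≡ ‖ G q * (g + 1ℤ) ‖)
  pair-of-same-type i≢j _ _ (inj₁ i≡j) = ⊥-elim (i≢j i≡j)
  pair-of-same-type {j = j} _ i<L _ (inj₂ (inj₁ refl)) =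
    j , i<L , sym (τ-+m j) , trans (cdE-sym p (edge (j ℕ.+ m)) (edge j)) (pair-cd j)
  pair-of-same-type {i} _ _ j<L (inj₂ (inj₂ refl)) = i , j<L , refl , pair-cd i

  same-type-pair : ∀ {i j} → i ℕ.< #edges → j ℕ.< #edges → i ≢ j → τ i ≡ τ j →
                   ∃[ q ] (q ℕ.+ m ℕ.< #edges × τ q ≡ τ i × cdE p (edge i) (edge j) ≡ ‖ G q * (g + 1ℤ) ‖)
  same-type-pair {i} {j} i<L j<L i≢j τi≡τj =
    pair-of-same-type i≢j i<L j<L (G-≋±-injective (<2m i<L) (<2m j<L) (τ≡τ⇒G≋±G {i} {j} τi≡τj))
    where <2m : ∀ {k} → k ℕ.< #edges → k ℕ.< m ℕ.+ m
          <2m {k} k<L = subst (k ℕ.<_) suc-#edges (ℕₚ.m<n⇒m<1+n k<L)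

  pair-exists⇒m≥2 : ∀ {q} → q ℕ.+ m ℕ.< #edges → 2 ℕ.≤ m
  pair-exists⇒m≥2 {q} q+m<L = pred>0⇒≥2 m (ℕₚ.+-cancelˡ-< m 0 (ℕ.pred m) (ℕₚ.≤-<-trans m+0≤q+m q+m<L))
    where
    m+0≤q+m : m ℕ.+ 0 ℕ.≤ q ℕ.+ m
    m+0≤q+m = ℕₚ.≤-trans (ℕₚ.≤-reflexive (ℕₚ.+-identityʳ m)) (ℕₚ.m≤n+m m q)
    pred>0⇒≥2 : ∀ n → 0 ℕ.< ℕ.pred n → 2 ℕ.≤ n
    pred>0⇒≥2 (suc (suc n)) _ = s≤s (s≤s z≤n)

  path-GP3 : GP3 p path
  path-GP3 = subst (SeparatedPairs p) (sym pathEdges-path) (separatedPairs-applyUpTo p edge #edges separated)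
    where
    separated : ∀ {i j k l} → i ℕ.< #edges → j ℕ.< #edges → k ℕ.< #edges → l ℕ.< #edges → i ≢ j → k ≢ l →
                etype p (edge i) ≡ etype p (edge j) → etype p (edge k) ≡ etype p (edge l) →
                etype p (edge k) ≢ etype p (edge i) → cdE p (edge k) (edge l) ≢ cdE p (edge i) (edge j)
    separated {i} {j} {k} {l} i<L j<L k<L l<L i≢j k≢l tᵢ≡tⱼ tₖ≡tₗ tₖ≢tᵢ cdₖₗ≡cdᵢⱼ =
      let q₁ , q₁+m<L , τq₁≡τi , cdᵢⱼ = same-type-pair i<L j<L i≢j (as-τ {i} {j} tᵢ≡tⱼ)
          q₂ , _      , τq₂≡τk , cdₖₗ = same-type-pair k<L l<L k≢l (as-τ {k} {l} tₖ≡tₗ)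
          τq₂≡τq₁ = pair-cd-injective {q₂} {q₁} (pair-exists⇒m≥2 q₁+m<L)
                                      (trans (sym cdₖₗ) (trans cdₖₗ≡cdᵢⱼ cdᵢⱼ))
      in tₖ≢tᵢ (trans (etype-edge k) (trans (sym τq₂≡τk) (trans τq₂≡τq₁ (trans τq₁≡τi (sym (etype-edge i))))))
      where
      as-τ : ∀ {a b} → etype p (edge a) ≡ etype p (edge b) → τ a ≡ τ b
      as-τ {a} {b} eq = trans (sym (etype-edge a)) (trans eq (etype-edge b))

  generator-path : IsGeneratorPath p path
  generator-path = path-unique , path-GP1 , path-GP2 , path-GP3

lemma3p4 : (n : ℕ) → Prime n → n % 2 ≡ 1 →
    Σ[ P ∈ List (Fin n) ] IsGeneratorPath n P
lemma3p4 n n-prime n-odd =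
  subst (λ k → Σ[ P ∈ List (Fin k) ] IsGeneratorPath k P) (sym n≡p) (path , generator-path)
  where
  n≡p : n ≡ ℕ.suc (n / 2 ℕ.+ n / 2)
  n≡p = Arithmetic.odd⇒≡suc[h+h] n-odd
  open GeneratorPath (n / 2) (subst Prime n≡p n-prime) using (path; generator-path)
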